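{- There are positive existential formulas $\mu_1(x,y,w)$, $\mu_2(x,y,w)$, $\mu_3(x,y,w)$ such that for every prime $p$: (1) $\mu_1$ is a formula of the language $\{0,1,+,R\}$ and $\mathfrak{N}_p\models\mu_1(a,b,c)$ iff $c=ab$, for all $a,b,c\in\mathbb{N}$; (2) $\mu_2$ is a formula of the language $\{0,1,+,\mathrm{pos},R\}$ and $\mathfrak{Z}_p\models\mu_2(a,b,c)$ iff $c=ab$, for all $a,b,c\in\mathbb{Z}$; (3) $\mu_3$ is a formula of the language $\{0,1,+,\mid,R,T\}$ and $\mathfrak{D}_p\models\mu_3(a,b,c)$ iff $c=ab$, for all $a,b,c\in\mathbb{Z}$. That is, multiplication is uniformly positive existentially definable in each of the classes $\{\mathfrak{N}_p\}$, $\{\mathfrak{Z}_p\}$, $\{\mathfrak{D}_p\}$ ($p$ ranging over all primes).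
   Context: For a prime $p$, $x\mid_p y$ means there exists $s\in\mathbb{Z}$ with $y=\pm xp^s$. $\mathfrak{N}_p=(\mathbb{N};0,1,+,\mid_p)$ (with $\mathbb{N}$ containing $0$ and $R$ interpreted as $\mid_p$); $\mathfrak{Z}_p=(\mathbb{Z};0,1,+,\geq0,\mid_p)$ where the unary predicate $\mathrm{pos}(x)$ means $x\geq 0$ and $R$ is $\mid_p$; $\mathfrak{D}_p=(\mathbb{Z};0,1,+,\mid,\mid_p,\mathbb{Z}\smallsetminus\{ -1,0,1\})$ where $\mid$ is the usual divisibility, $R$ is $\mid_p$, and the unary predicate $T$ is interpreted as the set $\mathbb{Z}\smallsetminus\{ -1,0,1\}$. -}

module Defs where

open import Data.Nat as ℕ using (ℕ)
open import Data.Integer as ℤ using (ℤ)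
open import Data.Integer.Divisibility as ℤD using ()
open import Data.Fin using (Fin)
open import Data.Vec using (Vec; []; _∷_; lookup)
open import Data.Product using (Σ; _×_; ∃)
open import Data.Sum using (_⊎_)
open import Relation.Nullary using (¬_)
open import Relation.Binary.PropositionalEquality using (_≡_)

-- First-order syntax over the base signature {0, 1, +} extended by a
-- family of relation symbols  Rel : ℕ → Set  (indexed by arity).
-- Variables are de Bruijn indices into Fin n.

data Term (n : ℕ) : Set where
  var  : Fin n → Term n
  `0   : Term n
  `1   : Term n
  _`+_ : Term n → Term n → Term n

data PEFormula (Rel : ℕ → Set) (n : ℕ) : Set where
  _`≈_ : Term n → Term n → PEFormula Rel n
  rel  : ∀ {k} → Rel k → Vec (Term n) k → PEFormula Rel n
  _`∧_ : PEFormula Rel n → PEFormula Rel n → PEFormula Rel n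
  _`∨_ : PEFormula Rel n → PEFormula Rel n → PEFormula Rel n
  `∃   : PEFormula Rel (ℕ.suc n) → PEFormula Rel n

record Structure (Rel : ℕ → Set) : Set₁ where
  field
    Carrier : Set
    zero′   : Carrier
    one′    : Carrier
    plus′   : Carrier → Carrier → Carrier
    interp  : ∀ {k} → Rel k → Vec Carrier k → Set

module _ {Rel : ℕ → Set} (M : Structure Rel) where
  open Structure M

  evalT : ∀ {n} → Vec Carrier n → Term n → Carrier
  evalT ρ (var i)   = lookup ρ i
  evalT ρ `0        = zero′
  evalT ρ `1        = one′
  evalT ρ (s `+ t)  = plus′ (evalT ρ s) (evalT ρ t)

  evalTs : ∀ {n k} → Vec Carrier n → Vec (Term n) k → Vec Carrier k
  evalTs ρ []       = []
  evalTs ρ (t ∷ ts) = evalT ρ t ∷ evalTs ρ ts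

  Sat : ∀ {n} → Vec Carrier n → PEFormula Rel n → Set
  Sat ρ (s `≈ t)  = evalT ρ s ≡ evalT ρ t
  Sat ρ (rel r ts) = interp r (evalTs ρ ts)
  Sat ρ (φ `∧ ψ)  = Sat ρ φ × Sat ρ ψ
  Sat ρ (φ `∨ ψ)  = Sat ρ φ ⊎ Sat ρ ψ
  Sat ρ (`∃ φ)    = Σ Carrier λ a → Sat (a ∷ ρ) φ

-- The relation x ∣ₚ y : ∃ s ∈ ℤ, y = ± x p^s.
-- Unfolded: s ≥ 0 gives y = ± x p^s; s = -t < 0 gives x = ± y p^t.

∣ₚℤ : ℕ → ℤ → ℤ → Set
∣ₚℤ p x y = Σ ℕ λ s →
    (y ≡ x ℤ.* ((ℤ.+ p) ℤ.^ s)) ⊎ (y ≡ ℤ.- (x ℤ.* ((ℤ.+ p) ℤ.^ s)))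
  ⊎ (x ≡ y ℤ.* ((ℤ.+ p) ℤ.^ s)) ⊎ (x ≡ ℤ.- (y ℤ.* ((ℤ.+ p) ℤ.^ s)))

∣ₚℕ : ℕ → ℕ → ℕ → Set
∣ₚℕ p x y = Σ ℕ λ s → (y ≡ x ℕ.* (p ℕ.^ s)) ⊎ (x ≡ y ℕ.* (p ℕ.^ s))

data LangN : ℕ → Set where
  R : LangN 2

data LangZ : ℕ → Set where
  pos : LangZ 1
  R   : LangZ 2

data LangD : ℕ → Set where
  dvd : LangD 2
  R   : LangD 2
  T   : LangD 1

𝔑 : ℕ → Structure LangN
𝔑 p = record
  { Carrier = ℕ ; zero′ = 0 ; one′ = 1 ; plus′ = ℕ._+_
  ; interp = λ { R (x ∷ y ∷ []) → ∣ₚℕ p x y } }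

ℨ : ℕ → Structure LangZ
ℨ p = record
  { Carrier = ℤ ; zero′ = ℤ.0ℤ ; one′ = ℤ.1ℤ ; plus′ = ℤ._+_
  ; interp = λ { pos (x ∷ []) → ℤ.0ℤ ℤ.≤ x
               ; R (x ∷ y ∷ []) → ∣ₚℤ p x y } }

NonUnitNonZero : ℤ → Set
NonUnitNonZero x = ¬ (x ≡ ℤ.-1ℤ) × ¬ (x ≡ ℤ.0ℤ) × ¬ (x ≡ ℤ.1ℤ)

𝔇 : ℕ → Structure LangD
𝔇 p = record
  { Carrier = ℤ ; zero′ = ℤ.0ℤ ; one′ = ℤ.1ℤ ; plus′ = ℤ._+_
  ; interp = λ { dvd (x ∷ y ∷ []) → x ℤD.∣ y
               ; R (x ∷ y ∷ []) → ∣ₚℤ p x y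
               ; T (x ∷ []) → NonUnitNonZero x } }

module Submission where

-- 𝔑ₚ: the relation |ₚ yields products with powers of p (MulPow).  For a power
-- u of p, the base-u repunit R = 1 + u + … + u^(a-1) satisfies uᵃ - 1 = R·(u-1)
-- and R ≡ a (mod u - 1), and this is expressible (Repunit).  Taking
-- v = uᵃ - 1 and w = (v + 1)ᵇ - 1 = u^(ab) - 1 and reading w once more in base
-- u gives c ≡ ab (mod u - 1) for any c certified by w, hence c = ab when
-- u ≫ a, b (μ₁).
-- ℨₚ: relativise μ₁ to the nonnegative integers and write a = A - A′,
-- b = B - B′ with A, A′, B, B′ ≥ 0 (μ₂).
-- 𝔇ₚ: there is no order, so we first define the positive powers of p
-- (PosPow), products with powers of p (MulPowD) and smallness |x| < z
-- (Small: x divides some Bʲ - Bⁱ ≤ z, which exists by pigeonhole), and then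
-- run the same repunit congruence with "U ∣ e and U² ∣ e - k·U" in place of
-- exact division (RepD, μ₃).

module Substitution where

  open import Defs
  open import Data.Nat using (ℕ; zero; suc; _+_; _<?_)
  open import Data.Fin using (zero; suc; #_)
  open import Data.Vec using (Vec; []; _∷_; lookup)
  open import Data.Product using (_,_)
  open import Data.Sum using (inj₁; inj₂)
  open import Relation.Binary.PropositionalEquality using (_≡_; refl; sym; trans; cong; cong₂; subst)
  open import Relation.Nullary.Decidable using (True)

  v : ∀ {n} (k : ℕ) {k<n : True (k <? n)} → Term n
  v {n} k {k<n} = var (#_ k {n} {k<n})

  ∃ⁿ : ∀ {Rel n} (k : ℕ) → PEFormula Rel (k + n) → PEFormula Rel n
  ∃ⁿ zero    φ = φ
  ∃ⁿ (suc k) φ = ∃ⁿ k (`∃ φ)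

  wkT : ∀ {n} → Term n → Term (suc n)
  wkT (var i)  = var (suc i)
  wkT `0       = `0
  wkT `1       = `1
  wkT (s `+ t) = wkT s `+ wkT t

  wkTs : ∀ {n k} → Vec (Term n) k → Vec (Term (suc n)) k
  wkTs []       = []
  wkTs (t ∷ ts) = wkT t ∷ wkTs ts

  subT : ∀ {n m} → Vec (Term m) n → Term n → Term m
  subT σ (var i)  = lookup σ i
  subT σ `0       = `0
  subT σ `1       = `1
  subT σ (s `+ t) = subT σ s `+ subT σ t

  subTs : ∀ {n m k} → Vec (Term m) n → Vec (Term n) k → Vec (Term m) k
  subTs σ []       = []
  subTs σ (t ∷ ts) = subT σ t ∷ subTs σ ts

  -- φ[σ]: substituting the terms σ for the free variables of φ.  The result
  -- is again positive existential, so formulas can be used as macros.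
  subF : ∀ {Rel n m} → Vec (Term m) n → PEFormula Rel n → PEFormula Rel m
  subF σ (s `≈ t)   = subT σ s `≈ subT σ t
  subF σ (rel r ts) = rel r (subTs σ ts)
  subF σ (φ `∧ ψ)   = subF σ φ `∧ subF σ ψ
  subF σ (φ `∨ ψ)   = subF σ φ `∨ subF σ ψ
  subF σ (`∃ φ)     = `∃ (subF (var zero ∷ wkTs σ) φ)

  module SubstitutionLemma {Rel : ℕ → Set} (M : Structure Rel) where
    open Structure M

    private
      evalT-wk : ∀ {n} a (ρ : Vec Carrier n) t → evalT M (a ∷ ρ) (wkT t) ≡ evalT M ρ t
      evalT-wk a ρ (var i)  = refl
      evalT-wk a ρ `0       = refl
      evalT-wk a ρ `1       = refl
      evalT-wk a ρ (s `+ t) = cong₂ plus′ (evalT-wk a ρ s) (evalT-wk a ρ t)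

      evalTs-wk : ∀ {n k} a (ρ : Vec Carrier n) (ts : Vec (Term n) k) →
                  evalTs M (a ∷ ρ) (wkTs ts) ≡ evalTs M ρ ts
      evalTs-wk a ρ []       = refl
      evalTs-wk a ρ (t ∷ ts) = cong₂ _∷_ (evalT-wk a ρ t) (evalTs-wk a ρ ts)

      lookup-evalTs : ∀ {n k} (ρ : Vec Carrier n) (σ : Vec (Term n) k) i →
                      lookup (evalTs M ρ σ) i ≡ evalT M ρ (lookup σ i)
      lookup-evalTs ρ (t ∷ σ) zero    = refl
      lookup-evalTs ρ (t ∷ σ) (suc i) = lookup-evalTs ρ σ i

      evalT-sub : ∀ {n m} (ρ : Vec Carrier m) (σ : Vec (Term m) n) t →
                  evalT M ρ (subT σ t) ≡ evalT M (evalTs M ρ σ) t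
      evalT-sub ρ σ (var i)  = sym (lookup-evalTs ρ σ i)
      evalT-sub ρ σ `0       = refl
      evalT-sub ρ σ `1       = refl
      evalT-sub ρ σ (s `+ t) = cong₂ plus′ (evalT-sub ρ σ s) (evalT-sub ρ σ t)

      evalTs-sub : ∀ {n m k} (ρ : Vec Carrier m) (σ : Vec (Term m) n) (ts : Vec (Term n) k) →
                   evalTs M ρ (subTs σ ts) ≡ evalTs M (evalTs M ρ σ) ts
      evalTs-sub ρ σ []       = refl
      evalTs-sub ρ σ (t ∷ ts) = cong₂ _∷_ (evalT-sub ρ σ t) (evalTs-sub ρ σ ts)

      evalTs-lift : ∀ {n m} a (ρ : Vec Carrier m) (σ : Vec (Term m) n) →
                    evalTs M (a ∷ ρ) (var zero ∷ wkTs σ) ≡ a ∷ evalTs M ρ σ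
      evalTs-lift a ρ σ = cong (a ∷_) (evalTs-wk a ρ σ)

    subF⇒ : ∀ {n m} (ρ : Vec Carrier m) (σ : Vec (Term m) n) φ →
            Sat M ρ (subF σ φ) → Sat M (evalTs M ρ σ) φ
    subF⇐ : ∀ {n m} (ρ : Vec Carrier m) (σ : Vec (Term m) n) φ →
            Sat M (evalTs M ρ σ) φ → Sat M ρ (subF σ φ)
    subF⇒ ρ σ (s `≈ t)   h = trans (sym (evalT-sub ρ σ s)) (trans h (evalT-sub ρ σ t))
    subF⇒ ρ σ (rel r ts) h = subst (interp r) (evalTs-sub ρ σ ts) h
    subF⇒ ρ σ (φ `∧ ψ) (h₁ , h₂) = subF⇒ ρ σ φ h₁ , subF⇒ ρ σ ψ h₂
    subF⇒ ρ σ (φ `∨ ψ) (inj₁ h)  = inj₁ (subF⇒ ρ σ φ h)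
    subF⇒ ρ σ (φ `∨ ψ) (inj₂ h)  = inj₂ (subF⇒ ρ σ ψ h)
    subF⇒ ρ σ (`∃ φ) (a , h) =
      a , subst (λ e → Sat M e φ) (evalTs-lift a ρ σ) (subF⇒ (a ∷ ρ) (var zero ∷ wkTs σ) φ h)
    subF⇐ ρ σ (s `≈ t)   h = trans (evalT-sub ρ σ s) (trans h (sym (evalT-sub ρ σ t)))
    subF⇐ ρ σ (rel r ts) h = subst (interp r) (sym (evalTs-sub ρ σ ts)) h
    subF⇐ ρ σ (φ `∧ ψ) (h₁ , h₂) = subF⇐ ρ σ φ h₁ , subF⇐ ρ σ ψ h₂
    subF⇐ ρ σ (φ `∨ ψ) (inj₁ h)  = inj₁ (subF⇐ ρ σ φ h)
    subF⇐ ρ σ (φ `∨ ψ) (inj₂ h)  = inj₂ (subF⇐ ρ σ ψ h)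
    subF⇐ ρ σ (`∃ φ) (a , h) =
      a , subF⇐ (a ∷ ρ) (var zero ∷ wkTs σ) φ (subst (λ e → Sat M e φ) (sym (evalTs-lift a ρ σ)) h)

module Naturals where

  open import Defs
  open Substitution
  open import Data.Nat
  open import Data.Nat.Properties
  open import Data.Nat.Divisibility
  open import Data.Nat.DivMod using (_%_; m<n⇒m%n≡m; [m+kn]%n≡m%n)
  open import Data.Nat.Tactic.RingSolver using (solve-∀)
  open import Data.Vec using ([]; _∷_)
  open import Data.Product using (Σ; _,_)
  open import Data.Sum using (inj₁; inj₂)
  open import Data.Empty using (⊥-elim)
  open import Relation.Nullary using (¬_; yes; no)
  open import Relation.Binary.Definitions using (tri<; tri≈; tri>)
  open import Relation.Binary.PropositionalEquality

  mod-unique : ∀ {c d U} m k .{{_ : NonZero U}} → c < U → d < U →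
               c + m * U ≡ d + k * U → c ≡ d
  mod-unique {c} {d} {U} m k c<U d<U e = begin
    c                ≡⟨ m<n⇒m%n≡m c<U ⟨
    c % U            ≡⟨ [m+kn]%n≡m%n c m U ⟨
    (c + m * U) % U  ≡⟨ cong (_% U) e ⟩
    (d + k * U) % U  ≡⟨ [m+kn]%n≡m%n d k U ⟩
    d % U            ≡⟨ m<n⇒m%n≡m d<U ⟩
    d                ∎
    where open ≡-Reasoning

  -- Writing x = X + 1 they satisfy
  --   rep·X = xⁿ - 1   and   rep = n + quo·X,
  -- i.e. the base-x repunit of length n is ≡ n modulo x - 1.
  rep : ℕ → ℕ → ℕ
  rep x zero    = 0
  rep x (suc n) = rep x n + x ^ n

  quo : ℕ → ℕ → ℕ
  quo x zero    = 0
  quo x (suc n) = quo x n + rep x n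

  rep-geometric : ∀ x n → rep x n * x + 1 ≡ rep x n + x ^ n
  rep-geometric x zero    = refl
  rep-geometric x (suc n) = begin
    (rep x n + x ^ n) * x + 1       ≡⟨ distrib (rep x n) (x ^ n) x ⟩
    (rep x n * x + 1) + x ^ n * x   ≡⟨ cong₂ _+_ (rep-geometric x n) (*-comm (x ^ n) x) ⟩
    rep x n + x ^ n + x * x ^ n     ∎
    where
      open ≡-Reasoning
      distrib : ∀ r y x → (r + y) * x + 1 ≡ (r * x + 1) + y * x
      distrib = solve-∀

  rep-congruent : ∀ x n → rep x n + quo x n ≡ n + quo x n * x
  rep-congruent x zero    = refl
  rep-congruent x (suc n) = begin
    rep x n + x ^ n + (quo x n + rep x n)    ≡⟨ regroup (rep x n) (x ^ n) (quo x n) ⟩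
    (rep x n + quo x n) + (rep x n + x ^ n)  ≡⟨ cong₂ _+_ (rep-congruent x n) (sym (rep-geometric x n)) ⟩
    (n + quo x n * x) + (rep x n * x + 1)    ≡⟨ collect n (quo x n) (rep x n) x ⟩
    suc n + (quo x n + rep x n) * x          ∎
    where
      open ≡-Reasoning
      regroup : ∀ r y q → r + y + (q + r) ≡ (r + q) + (r + y)
      regroup = solve-∀
      collect : ∀ n q r x → (n + q * x) + (r * x + 1) ≡ suc n + (q + r) * x
      collect = solve-∀

  -- rep·x = rep + (xⁿ - 1): the form in which the formula Repunit below
  -- certifies the repunit.
  rep-times : ∀ x n → 1 ≤ x ^ n → rep x n + (x ^ n ∸ 1) ≡ rep x n * x
  rep-times x n 1≤xⁿ = +-cancelʳ-≡ 1 _ _ (begin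
    rep x n + (x ^ n ∸ 1) + 1  ≡⟨ +-assoc (rep x n) (x ^ n ∸ 1) 1 ⟩
    rep x n + (x ^ n ∸ 1 + 1)  ≡⟨ cong (rep x n +_) (m∸n+n≡m 1≤xⁿ) ⟩
    rep x n + x ^ n            ≡⟨ rep-geometric x n ⟨
    rep x n * x + 1            ∎)
    where open ≡-Reasoning

  repunit-value : ∀ U n → suc U ^ n ∸ 1 ≡ rep (suc U) n * U
  repunit-value U n = begin
    x ^ n ∸ 1      ≡⟨ cong (_∸ 1) (+-cancelˡ-≡ r _ _ (trans (sym (rep-geometric x n)) (expand r U))) ⟩
    r * U + 1 ∸ 1  ≡⟨ m+n∸n≡m (r * U) 1 ⟩
    r * U          ∎
    where
      open ≡-Reasoning
      x = suc U
      r = rep x n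
      expand : ∀ r U → r * suc U + 1 ≡ r + (r * U + 1)
      expand = solve-∀

  repunit-residue : ∀ U n → rep (suc U) n ≡ n + quo (suc U) n * U
  repunit-residue U n = +-cancelʳ-≡ (quo x n) _ _ (trans (rep-congruent x n) (expand n (quo x n) U))
    where
      x = suc U
      expand : ∀ n q U → n + q * suc U ≡ n + q * U + q
      expand = solve-∀

  record RepunitWitness (k X e : ℕ) : Set where
    constructor witness
    field
      r m   : ℕ
      e≡r·X : e ≡ r * X
      r≡    : r ≡ k + m * X

  -- The arithmetic heart of the definition of multiplication: if
  --   v = R₁·U with R₁ ≡ a (mod U),   w = R₂·v with R₂ ≡ b (mod v),
  --   w = R₃·U with R₃ ≡ c (mod U),
  -- then R₃ = R₂R₁ ≡ ab (mod U) (as U ∣ v), so c = ab as soon as ab, c < U.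
  repunit-product : ∀ {a b c U v w} → RepunitWitness a U v → RepunitWitness b v w →
                    RepunitWitness c U w → a * b < U → c < U → c ≡ a * b
  repunit-product {a} {b} {c} {U} {v} {w}
    (witness R₁ m₁ v≡R₁U R₁≡) (witness R₂ m₂ w≡R₂v R₂≡) (witness R₃ m₃ w≡R₃U R₃≡) ab<U c<U =
    mod-unique m₃ (b * m₁ + m₂ * R₁ * a + m₂ * R₁ * m₁ * U) c<U ab<U (begin
      c + m₃ * U                        ≡⟨ R₃≡ ⟨
      R₃                                ≡⟨ *-cancelʳ-≡ R₃ (R₂ * R₁) U R₃U≡R₂R₁U ⟩
      R₂ * R₁                           ≡⟨ cong₂ _*_ (trans R₂≡ (cong (λ t → b + m₂ * t) v≡R₁U)) R₁≡ ⟩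
      (b + m₂ * (R₁ * U)) * (a + m₁ * U) ≡⟨ expand a b m₁ m₂ R₁ U ⟩
      a * b + (b * m₁ + m₂ * R₁ * a + m₂ * R₁ * m₁ * U) * U ∎)
    where
      open ≡-Reasoning
      instance
        U≢0 : NonZero U
        U≢0 = >-nonZero (≤-<-trans z≤n c<U)
      R₃U≡R₂R₁U : R₃ * U ≡ R₂ * R₁ * U
      R₃U≡R₂R₁U = begin
        R₃ * U         ≡⟨ w≡R₃U ⟨
        w              ≡⟨ w≡R₂v ⟩
        R₂ * v         ≡⟨ cong (R₂ *_) v≡R₁U ⟩
        R₂ * (R₁ * U)  ≡⟨ *-assoc R₂ R₁ U ⟨
        R₂ * R₁ * U    ∎
      expand : ∀ a b m₁ m₂ R₁ U → (b + m₂ * (R₁ * U)) * (a + m₁ * U)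
               ≡ a * b + (b * m₁ + m₂ * R₁ * a + m₂ * R₁ * m₁ * U) * U
      expand = solve-∀

  product-bound : ∀ {a b u₀} → a < u₀ → b < u₀ → 1 < u₀ → a * b + 1 < u₀ * u₀
  product-bound {a} {b} {suc (suc x)} (s≤s a≤) (s≤s b≤) _ = begin-strict
    a * b + 1                             ≤⟨ +-monoˡ-≤ 1 (*-mono-≤ a≤ b≤) ⟩
    suc x * suc x + 1                     <⟨ m<m+n _ (s≤s z≤n) ⟩
    suc x * suc x + 1 + suc (suc (x + x)) ≡⟨ square x ⟩
    suc (suc x) * suc (suc x)             ∎
    where
      open ≤-Reasoning
      square : ∀ x → suc x * suc x + 1 + suc (suc (x + x)) ≡ suc (suc x) * suc (suc x)
      square = solve-∀
  product-bound {u₀ = suc zero} _ _ (s≤s ())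

  RepunitRel : ℕ → ℕ → ℕ → Set
  RepunitRel k x e = ∀ X → x ≡ suc X → RepunitWitness k X e

  multiplication-by-repunits : ∀ {a b c u₀ u v w} → u ≡ u₀ * u₀ →
    a < u₀ → b < u₀ → 1 < u₀ → c + 1 < u →
    RepunitRel a u v → RepunitRel b (v + 1) w → RepunitRel c u w → c ≡ a * b
  multiplication-by-repunits {u = zero} _ _ _ _ ()
  multiplication-by-repunits {a} {b} {c} {u = suc U} {v} u≡ a<u₀ b<u₀ 1<u₀ (s≤s c+1≤U) repA repB repC
    = repunit-product (repA U refl) (repB v (+-comm v 1)) (repC U refl) ab<U c<U
    where
      ab<U : a * b < U
      ab<U = subst (_≤ U) (+-comm (a * b) 1)
               (≤-pred (subst (a * b + 1 <_) (sym u≡) (product-bound a<u₀ b<u₀ 1<u₀)))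
      c<U : c < U
      c<U = subst (_≤ U) (+-comm c 1) c+1≤U

  -- Arithmetic of the powers of a fixed base p = 2 + q ≥ 2.
  module PowersOf (q : ℕ) where

    p : ℕ
    p = 2 + q

    1<p : 1 < p
    1<p = s≤s (s≤s z≤n)

    p∤1 : ¬ p ∣ 1
    p∤1 p∣1 with ∣1⇒≡1 p∣1
    ... | ()

    pow-< : ∀ {t s} → t < s → p ^ t < p ^ s
    pow-< = ^-monoʳ-< p 1<p

    pow-≤ : ∀ {t s} → t ≤ s → p ^ t ≤ p ^ s
    pow-≤ = ^-monoʳ-≤ p

    pow-+ : ∀ t d → p ^ (t + d) ≡ p ^ t * p ^ d
    pow-+ = ^-distribˡ-+-* p

    pow-split : ∀ {t s} → t < s → Σ ℕ λ d → s ≡ t + suc d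
    pow-split {t} t<s with m≤n⇒∃[o]m+o≡n t<s
    ... | d , e = d , trans (sym e) (sym (+-suc t d))

    n<pⁿ : ∀ n → n < p ^ n
    n<pⁿ zero    = s≤s z≤n
    n<pⁿ (suc n) = begin-strict
      suc n              <⟨ s≤s (n<pⁿ n) ⟩
      suc (p ^ n)        ≤⟨ +-monoˡ-≤ (p ^ n) (m^n>0 p n) ⟩
      p ^ n + p ^ n      ≤⟨ +-monoʳ-≤ (p ^ n) (m≤m+n (p ^ n) (q * p ^ n)) ⟩
      p * p ^ n          ∎
      where open ≤-Reasoning

    cancel-pow : ∀ t {X Y} → p ^ t * X ≡ p ^ t * Y → X ≡ Y
    cancel-pow t {X} {Y} = *-cancelˡ-≡ X Y (p ^ t) {{m^n≢0 p t}}

    -- If  n·pᵗ + pˢ = (n+1)·pʳ  with p ∤ n, then t = s: otherwise either the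
    -- right side is too small (r ≤ min t s), or dividing by p^(min t s)
    -- leaves an equation forcing p ∣ n (t < s) or p ∣ 1 (s < t).
    exponents-agree : ∀ n t s r → ¬ p ∣ n → n * p ^ t + p ^ s ≡ suc n * p ^ r → t ≡ s
    exponents-agree n t s r p∤n eq with <-cmp t s
    ... | tri≈ _ t≡s _ = t≡s
    ... | tri< t<s _ _ with r ≤? t
    ...   | yes r≤t = ⊥-elim (<-irrefl (sym eq) (begin-strict
              suc n * p ^ r      ≤⟨ *-monoʳ-≤ (suc n) (pow-≤ r≤t) ⟩
              p ^ t + n * p ^ t  ≡⟨ +-comm (p ^ t) (n * p ^ t) ⟩
              n * p ^ t + p ^ t  <⟨ +-monoʳ-< (n * p ^ t) (pow-< t<s) ⟩
              n * p ^ t + p ^ s  ∎))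
      where open ≤-Reasoning
    ...   | no r≰t with pow-split t<s | pow-split (≰⇒> r≰t)
    ...     | k , refl | j , refl = ⊥-elim (p∤n (∣m+n∣m⇒∣n p∣pᵏ⁺¹+n (m∣m*n (p ^ k))))
      where
        reduced : n + p ^ suc k ≡ suc n * p ^ suc j
        reduced = cancel-pow t (begin
          p ^ t * (n + p ^ suc k)          ≡⟨ *-distribˡ-+ (p ^ t) n (p ^ suc k) ⟩
          p ^ t * n + p ^ t * p ^ suc k    ≡⟨ cong₂ _+_ (*-comm n (p ^ t)) (pow-+ t (suc k)) ⟨
          n * p ^ t + p ^ (t + suc k)      ≡⟨ eq ⟩
          suc n * p ^ (t + suc j)          ≡⟨ cong (suc n *_) (pow-+ t (suc j)) ⟩
          suc n * (p ^ t * p ^ suc j)      ≡⟨ *-comm-middle (suc n) (p ^ t) (p ^ suc j) ⟩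
          p ^ t * (suc n * p ^ suc j)      ∎)
          where
            open ≡-Reasoning
            *-comm-middle : ∀ a b c → a * (b * c) ≡ b * (a * c)
            *-comm-middle = solve-∀
        p∣pᵏ⁺¹+n : p ∣ p ^ suc k + n
        p∣pᵏ⁺¹+n = subst (p ∣_) (trans (sym reduced) (+-comm n _)) (∣n⇒∣m*n (suc n) (m∣m*n (p ^ j)))
    exponents-agree n t s r p∤n eq | tri> _ _ s<t with r ≤? s
    ...   | yes r≤s = ⊥-elim (<-irrefl (sym eq) (begin-strict
              suc n * p ^ r      ≤⟨ *-monoʳ-≤ (suc n) (pow-≤ r≤s) ⟩
              p ^ s + n * p ^ s  ≡⟨ +-comm (p ^ s) (n * p ^ s) ⟩
              n * p ^ s + p ^ s  <⟨ +-monoˡ-< (p ^ s) (*-monoʳ-< n {{n≢0}} (pow-< s<t)) ⟩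
              n * p ^ t + p ^ s  ∎))
      where
        open ≤-Reasoning
        n≢0 : NonZero n
        n≢0 = ≢-nonZero λ { refl → p∤n (p ∣0) }
    ...   | no r≰s with pow-split s<t | pow-split (≰⇒> r≰s)
    ...     | k , refl | j , refl = ⊥-elim (p∤1 (∣m+n∣m⇒∣n p∣n·pᵏ⁺¹+1 (∣n⇒∣m*n n (m∣m*n (p ^ k)))))
      where
        reduced : n * p ^ suc k + 1 ≡ suc n * p ^ suc j
        reduced = cancel-pow s (begin
          p ^ s * (n * p ^ suc k + 1)          ≡⟨ spread (p ^ s) n (p ^ suc k) ⟩
          n * (p ^ s * p ^ suc k) + p ^ s      ≡⟨ cong (λ x → n * x + p ^ s) (pow-+ s (suc k)) ⟨
          n * p ^ (s + suc k) + p ^ s          ≡⟨ eq ⟩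
          suc n * p ^ (s + suc j)              ≡⟨ cong (suc n *_) (pow-+ s (suc j)) ⟩
          suc n * (p ^ s * p ^ suc j)          ≡⟨ *-comm-middle (suc n) (p ^ s) (p ^ suc j) ⟩
          p ^ s * (suc n * p ^ suc j)          ∎)
          where
            open ≡-Reasoning
            spread : ∀ a n b → a * (n * b + 1) ≡ n * (a * b) + a
            spread = solve-∀
            *-comm-middle : ∀ a b c → a * (b * c) ≡ b * (a * c)
            *-comm-middle = solve-∀
        p∣n·pᵏ⁺¹+1 : p ∣ n * p ^ suc k + 1
        p∣n·pᵏ⁺¹+1 = subst (p ∣_) (sym reduced) (∣n⇒∣m*n (suc n) (m∣m*n (p ^ j)))

  Less : ∀ {L} → PEFormula L 2
  Less = `∃ (((v 1 `+ v 0) `+ `1) `≈ v 2)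

  _≺_ : ∀ {L n} → Term n → Term n → PEFormula L n
  x ≺ y = subF (x ∷ y ∷ []) Less

  -- MulPow(a, u, y):  "u is a power of p and y = a·u", expressed as
  --   1 |ₚ u  ∧  a ≤ y  ∧  a |ₚ y  ∧  a+1 |ₚ y+u  ∧  a+2 |ₚ y+2u.
  MulPow : PEFormula LangN 3
  MulPow = rel R (`1 ∷ v 1 ∷ [])
    `∧ (`∃ ((v 1 `+ v 0) `≈ v 3)
    `∧ (rel R (v 0 ∷ v 2 ∷ [])
    `∧ (rel R ((v 0 `+ `1) ∷ (v 2 `+ v 1) ∷ [])
    `∧  rel R (((v 0 `+ `1) `+ `1) ∷ ((v 2 `+ v 1) `+ v 1) ∷ []))))

  mulPow : ∀ {n} → Term n → Term n → Term n → PEFormula LangN n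
  mulPow a u y = subF (a ∷ u ∷ y ∷ []) MulPow

  -- Repunit(k, x, e):  ∃ r m Y.  r·x = r + e  ∧  m·x = Y  ∧  k + Y = r + m.
  -- For x = X + 1 a power of p this says  e = r·X  with  r ≡ k (mod X);
  -- it holds for e = xᵏ - 1, r the base-x repunit of length k.
  Repunit : PEFormula LangN 3
  Repunit = ∃ⁿ 3 (mulPow (v 2) (v 4) (v 2 `+ v 5)
    `∧ (mulPow (v 1) (v 4) (v 0)
    `∧ ((v 3 `+ v 0) `≈ (v 2 `+ v 1))))

  repunit : ∀ {n} → Term n → Term n → Term n → PEFormula LangN n
  repunit k x e = subF (k ∷ x ∷ e ∷ []) Repunit

  -- μ₁(a, b, c):  ∃ u₀ u v w.  u = u₀·u₀ ∧ Repunit(a, u, v) ∧ Repunit(b, v+1, w)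
  --   ∧ Repunit(c, u, w) ∧ a < u₀ ∧ b < u₀ ∧ 1 < u₀ ∧ c + 1 < u.
  -- Intended witnesses: u₀ a large power of p, v = uᵃ - 1, w = u^(ab) - 1.
  μ₁ : PEFormula LangN 3
  μ₁ = ∃ⁿ 4 (mulPow (v 3) (v 3) (v 2)
    `∧ (repunit (v 4) (v 2) (v 1)
    `∧ (repunit (v 5) (v 1 `+ `1) (v 0)
    `∧ (repunit (v 6) (v 2) (v 0)
    `∧ ((v 4 ≺ v 3) `∧ ((v 5 ≺ v 3) `∧ ((`1 ≺ v 3) `∧ ((v 6 `+ `1) ≺ v 2))))))))

  module Semantics𝔑 (q : ℕ) where
    open PowersOf q
    open SubstitutionLemma (𝔑 p)

    less-sound : ∀ {x y} → Sat (𝔑 p) (x ∷ y ∷ []) Less → x < y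
    less-sound {x} {y} (z , x+z+1≡y) =
      subst (_≤ y) (+-comm x 1) (subst (x + 1 ≤_) x+z+1≡y (+-monoˡ-≤ 1 (m≤m+n x z)))

    less-complete : ∀ {x y} → x < y → Sat (𝔑 p) (x ∷ y ∷ []) Less
    less-complete {x} x<y with m≤n⇒∃[o]m+o≡n x<y
    ... | z , e = z , trans (+-comm (x + z) 1) e

    unit-divₚ : ∀ {u} → ∣ₚℕ p 1 u → Σ ℕ λ s → u ≡ p ^ s
    unit-divₚ {u} (s , inj₁ e) = s , trans e (*-identityˡ _)
    unit-divₚ {u} (s , inj₂ e) = 0 , m*n≡1⇒m≡1 u (p ^ s) (sym e)

    divₚ-upward : ∀ {x y} → x ≤ y → ∣ₚℕ p x y → Σ ℕ λ t → y ≡ x * p ^ t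
    divₚ-upward x≤y (t , inj₁ e) = t , e
    divₚ-upward {x} {y} x≤y (zero , inj₂ e) =
      0 , trans (sym (*-identityʳ y)) (trans (sym e) (sym (*-identityʳ x)))
    divₚ-upward {y = zero}  z≤n (suc t , inj₂ _) = 0 , refl
    divₚ-upward {y = suc y} x≤y (suc t , inj₂ refl) =
      ⊥-elim (<-irrefl refl (≤-<-trans x≤y (m<m*n (suc y) (p ^ suc t) (pow-< {0} {suc t} (s≤s z≤n)))))

    mulPow-step : ∀ {n y} s → ¬ p ∣ n → (Σ ℕ λ t → y ≡ n * p ^ t) →
                  (Σ ℕ λ r → y + p ^ s ≡ (n + 1) * p ^ r) → y ≡ n * p ^ s
    mulPow-step {n} {y} s p∤n (t , y≡) (r , y+pˢ≡) =
      trans y≡ (cong (λ k → n * p ^ k) (exponents-agree n t s r p∤n (begin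
        n * p ^ t + p ^ s   ≡⟨ cong (_+ p ^ s) y≡ ⟨
        y + p ^ s           ≡⟨ y+pˢ≡ ⟩
        (n + 1) * p ^ r     ≡⟨ cong (_* p ^ r) (+-comm n 1) ⟩
        suc n * p ^ r       ∎)))
      where open ≡-Reasoning

    -- MulPow(a, u, y) implies y = a·u: apply mulPow-step to a if p ∤ a, and
    -- to a + 1 otherwise.
    mulPow-sound : ∀ {a u y} → Sat (𝔑 p) (a ∷ u ∷ y ∷ []) MulPow → y ≡ a * u
    mulPow-sound {a} {u} {y} (1∣u , (z , a+z≡y) , a∣y , a+1∣y+u , a+2∣y+2u) with unit-divₚ 1∣u
    ... | s , refl with p ∣? a
    ...   | no p∤a = mulPow-step s p∤a (divₚ-upward a≤y a∣y) (divₚ-upward a+1≤y+u a+1∣y+u)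
      where
        a≤y = subst (a ≤_) a+z≡y (m≤m+n a z)
        a+1≤y+u = +-mono-≤ a≤y (m^n>0 p s)
    ...   | yes p∣a = +-cancelʳ-≡ (p ^ s) y (a * p ^ s) (begin
              y + p ^ s          ≡⟨ mulPow-step s p∤a+1 (divₚ-upward a+1≤y+u a+1∣y+u)
                                                      (divₚ-upward a+2≤y+2u a+2∣y+2u) ⟩
              (a + 1) * p ^ s    ≡⟨ distrib a (p ^ s) ⟩
              a * p ^ s + p ^ s  ∎)
      where
        open ≡-Reasoning
        p∤a+1 : ¬ p ∣ a + 1
        p∤a+1 d = p∤1 (∣m+n∣m⇒∣n d p∣a)
        a≤y = subst (a ≤_) a+z≡y (m≤m+n a z)
        a+1≤y+u = +-mono-≤ a≤y (m^n>0 p s)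
        a+2≤y+2u = +-mono-≤ a+1≤y+u (m^n>0 p s)
        distrib : ∀ a x → (a + 1) * x ≡ a * x + x
        distrib = solve-∀

    mulPow-complete : ∀ a s {y} → y ≡ a * p ^ s → Sat (𝔑 p) (a ∷ p ^ s ∷ y ∷ []) MulPow
    mulPow-complete a s refl =
        (s , inj₁ (sym (*-identityˡ _)))
      , m≤n⇒∃[o]m+o≡n (m≤m*n a (p ^ s) {{m^n≢0 p s}})
      , (s , inj₁ refl)
      , (s , inj₁ (distrib₁ a (p ^ s)))
      , (s , inj₁ (distrib₂ a (p ^ s)))
      where
        distrib₁ : ∀ a x → a * x + x ≡ (a + 1) * x
        distrib₁ = solve-∀
        distrib₂ : ∀ a x → a * x + x + x ≡ (a + 1 + 1) * x
        distrib₂ = solve-∀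

    repunit-sound : ∀ {k x e} → Sat (𝔑 p) (k ∷ x ∷ e ∷ []) Repunit → RepunitRel k x e
    repunit-sound {k} {x} {e} (r , m , Y , hr , hm , k+Y≡r+m) X refl =
      witness r m (+-cancelˡ-≡ r e (r * X) r+e≡r+rX) (+-cancelʳ-≡ m r (k + m * X) r+m≡)
      where
        ρ = Y ∷ m ∷ r ∷ k ∷ suc X ∷ e ∷ []
        r+e≡r+rX : r + e ≡ r + r * X
        r+e≡r+rX = trans (mulPow-sound (subF⇒ ρ (v 2 ∷ v 4 ∷ (v 2 `+ v 5) ∷ []) MulPow hr)) (*-suc r X)
        r+m≡ : r + m ≡ k + m * X + m
        r+m≡ = begin
          r + m            ≡⟨ k+Y≡r+m ⟨
          k + Y            ≡⟨ cong (k +_) (mulPow-sound (subF⇒ ρ (v 1 ∷ v 4 ∷ v 0 ∷ []) MulPow hm)) ⟩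
          k + m * suc X    ≡⟨ rearrange k m X ⟩
          k + m * X + m    ∎
          where
            open ≡-Reasoning
            rearrange : ∀ k m X → k + m * suc X ≡ k + m * X + m
            rearrange = solve-∀

    repunit-complete : ∀ k s {x e} → x ≡ p ^ s → e ≡ x ^ k ∸ 1 → Sat (𝔑 p) (k ∷ x ∷ e ∷ []) Repunit
    repunit-complete k s {x} refl refl =
        rep x k , quo x k , quo x k * x
      , subF⇐ ρ (v 2 ∷ v 4 ∷ (v 2 `+ v 5) ∷ []) MulPow (mulPow-complete (rep x k) s (rep-times x k (m^n>0 x {{m^n≢0 p s}} k)))
      , subF⇐ ρ (v 1 ∷ v 4 ∷ v 0 ∷ []) MulPow (mulPow-complete (quo x k) s refl)
      , sym (rep-congruent x k)
      where
        ρ = quo x k * x ∷ quo x k ∷ rep x k ∷ k ∷ x ∷ x ^ k ∸ 1 ∷ []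

    μ₁-sound : ∀ a b c → Sat (𝔑 p) (a ∷ b ∷ c ∷ []) μ₁ → c ≡ a * b
    μ₁-sound a b c (u₀ , u , v′ , w , hu , ha , hb , hc , a<u₀ , b<u₀ , 1<u₀ , c+1<u) =
      multiplication-by-repunits
        (mulPow-sound (subF⇒ ρ (v 3 ∷ v 3 ∷ v 2 ∷ []) MulPow hu))
        (less-sound (subF⇒ ρ (v 4 ∷ v 3 ∷ []) Less a<u₀))
        (less-sound (subF⇒ ρ (v 5 ∷ v 3 ∷ []) Less b<u₀))
        (less-sound (subF⇒ ρ (`1 ∷ v 3 ∷ []) Less 1<u₀))
        (less-sound (subF⇒ ρ ((v 6 `+ `1) ∷ v 2 ∷ []) Less c+1<u))
        (repunit-sound (subF⇒ ρ (v 4 ∷ v 2 ∷ v 1 ∷ []) Repunit ha))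
        (repunit-sound (subF⇒ ρ (v 5 ∷ (v 1 `+ `1) ∷ v 0 ∷ []) Repunit hb))
        (repunit-sound (subF⇒ ρ (v 6 ∷ v 2 ∷ v 0 ∷ []) Repunit hc))
      where ρ = w ∷ v′ ∷ u ∷ u₀ ∷ a ∷ b ∷ c ∷ []

    -- Completeness: u₀ = p^(a+b+1), u = u₀², v = uᵃ - 1, w = u^(ab) - 1.
    μ₁-complete : ∀ a b → Sat (𝔑 p) (a ∷ b ∷ a * b ∷ []) μ₁
    μ₁-complete a b =
        u₀ , u , v′ , w
      , subF⇐ ρ (v 3 ∷ v 3 ∷ v 2 ∷ []) MulPow (mulPow-complete u₀ s refl)
      , subF⇐ ρ (v 4 ∷ v 2 ∷ v 1 ∷ []) Repunit (repunit-complete a (s + s) u≡ refl)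
      , subF⇐ ρ (v 5 ∷ (v 1 `+ `1) ∷ v 0 ∷ []) Repunit (repunit-complete b ((s + s) * a) v′+1≡ w≡)
      , subF⇐ ρ (v 6 ∷ v 2 ∷ v 0 ∷ []) Repunit (repunit-complete (a * b) (s + s) u≡ refl)
      , subF⇐ ρ (v 4 ∷ v 3 ∷ []) Less (less-complete a<u₀)
      , subF⇐ ρ (v 5 ∷ v 3 ∷ []) Less (less-complete b<u₀)
      , subF⇐ ρ (`1 ∷ v 3 ∷ []) Less (less-complete 1<u₀)
      , subF⇐ ρ ((v 6 `+ `1) ∷ v 2 ∷ []) Less (less-complete (product-bound a<u₀ b<u₀ 1<u₀))
      where
        s = suc (a + b)
        u₀ = p ^ s
        u = u₀ * u₀
        v′ = u ^ a ∸ 1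
        w = u ^ (a * b) ∸ 1
        ρ = w ∷ v′ ∷ u ∷ u₀ ∷ a ∷ b ∷ a * b ∷ []
        u≡ : u ≡ p ^ (s + s)
        u≡ = sym (pow-+ s s)
        uᵃ≡ : u ^ a ≡ p ^ ((s + s) * a)
        uᵃ≡ = trans (cong (_^ a) u≡) (^-*-assoc p (s + s) a)
        v′+1≡uᵃ : v′ + 1 ≡ u ^ a
        v′+1≡uᵃ = m∸n+n≡m (subst (1 ≤_) (sym uᵃ≡) (m^n>0 p ((s + s) * a)))
        v′+1≡ : v′ + 1 ≡ p ^ ((s + s) * a)
        v′+1≡ = trans v′+1≡uᵃ uᵃ≡
        w≡ : w ≡ (v′ + 1) ^ b ∸ 1
        w≡ = cong (_∸ 1) (trans (sym (^-*-assoc u a b)) (cong (_^ b) (sym v′+1≡uᵃ)))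
        a<u₀ : a < u₀
        a<u₀ = <-≤-trans (s≤s (m≤m+n a b)) (<⇒≤ (n<pⁿ s))
        b<u₀ : b < u₀
        b<u₀ = <-≤-trans (s≤s (m≤n+m b a)) (<⇒≤ (n<pⁿ s))
        1<u₀ : 1 < u₀
        1<u₀ = pow-< {0} {s} (s≤s z≤n)

module Integers where

  open import Defs
  open Substitution
  open Naturals using (μ₁; module PowersOf; module Semantics𝔑)
  open import Data.Nat as ℕ using (ℕ; zero; suc; z≤n)
  open import Data.Integer as ℤ using (ℤ; +_; -[1+_]; _+_; _*_; -_; +≤+)
  open import Data.Integer.Properties as ℤP using (pos-*; pos-+)
  open import Data.Integer.Tactic.RingSolver using (solve-∀)
  open import Data.Fin using (zero)
  open import Data.Vec using (Vec; []; _∷_; map)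
  open import Data.Vec.Properties using (lookup-map)
  open import Data.Product using (Σ; _×_; _,_)
  open import Data.Sum using (inj₁; inj₂)
  open import Relation.Binary.PropositionalEquality

  +-cancelʳ : ∀ {x y} k → x + k ≡ y + k → x ≡ y
  +-cancelʳ {x} {y} k e = begin
    x              ≡⟨ add-sub x k ⟩
    x + k + - k    ≡⟨ cong (_+ - k) e ⟩
    y + k + - k    ≡⟨ add-sub y k ⟨
    y              ∎
    where
      open ≡-Reasoning
      add-sub : ∀ x k → x ≡ x + k + - k
      add-sub = solve-∀

  module DivₚEmbedding (p : ℕ) where

    pow-+ℤ : ∀ s → (+ p) ℤ.^ s ≡ + (p ℕ.^ s)
    pow-+ℤ zero    = refl
    pow-+ℤ (suc s) = trans (cong (+ p *_) (pow-+ℤ s)) (sym (pos-* p (p ℕ.^ s)))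

    mul-pow-+ℤ : ∀ x s → + x * (+ p) ℤ.^ s ≡ + (x ℕ.* p ℕ.^ s)
    mul-pow-+ℤ x s = trans (cong (+ x *_) (pow-+ℤ s)) (sym (pos-* x _))

    private
      +-injective : ∀ {m n} → + m ≡ + n → m ≡ n
      +-injective refl = refl

      pos≡neg : ∀ m n → + m ≡ - (+ n) → (m ≡ 0) × (n ≡ 0)
      pos≡neg m zero    e  = +-injective e , refl
      pos≡neg m (suc n) ()

    divₚ-ℤ⇒ℕ : ∀ x y → ∣ₚℤ p (+ x) (+ y) → ∣ₚℕ p x y
    divₚ-ℤ⇒ℕ x y (s , inj₁ e) = s , inj₁ (+-injective (trans e (mul-pow-+ℤ x s)))
    divₚ-ℤ⇒ℕ x y (s , inj₂ (inj₁ e)) with pos≡neg y _ (trans e (cong -_ (mul-pow-+ℤ x s)))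
    ... | y≡0 , xpˢ≡0 = s , inj₁ (trans y≡0 (sym xpˢ≡0))
    divₚ-ℤ⇒ℕ x y (s , inj₂ (inj₂ (inj₁ e))) = s , inj₂ (+-injective (trans e (mul-pow-+ℤ y s)))
    divₚ-ℤ⇒ℕ x y (s , inj₂ (inj₂ (inj₂ e))) with pos≡neg x _ (trans e (cong -_ (mul-pow-+ℤ y s)))
    ... | x≡0 , ypˢ≡0 = s , inj₂ (trans x≡0 (sym ypˢ≡0))

    divₚ-ℕ⇒ℤ : ∀ x y → ∣ₚℕ p x y → ∣ₚℤ p (+ x) (+ y)
    divₚ-ℕ⇒ℤ x y (s , inj₁ e) = s , inj₁ (trans (cong +_ e) (sym (mul-pow-+ℤ x s)))
    divₚ-ℕ⇒ℤ x y (s , inj₂ e) = s , inj₂ (inj₂ (inj₁ (trans (cong +_ e) (sym (mul-pow-+ℤ y s)))))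

  ∃⁺ : ∀ {n} → PEFormula LangZ (suc n) → PEFormula LangZ n
  ∃⁺ φ = `∃ (rel pos (var zero ∷ []) `∧ φ)

  ∃⁺ⁿ : ∀ {n} (k : ℕ) → PEFormula LangZ (k ℕ.+ n) → PEFormula LangZ n
  ∃⁺ⁿ zero    φ = φ
  ∃⁺ⁿ (suc k) φ = ∃⁺ⁿ k (∃⁺ φ)

  relativise : ∀ {n} → PEFormula LangN n → PEFormula LangZ n
  relativise (s `≈ t)   = s `≈ t
  relativise (rel R ts) = rel R ts
  relativise (φ `∧ ψ)   = relativise φ `∧ relativise ψ
  relativise (φ `∨ ψ)   = relativise φ `∨ relativise ψ
  relativise (`∃ φ)     = ∃⁺ (relativise φ)

  module Relativisation (p : ℕ) where
    open DivₚEmbedding p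

    evalT-+ : ∀ {n} (ρ : Vec ℕ n) t → evalT (ℨ p) (map +_ ρ) t ≡ + evalT (𝔑 p) ρ t
    evalT-+ ρ (var i)  = lookup-map i +_ ρ
    evalT-+ ρ `0       = refl
    evalT-+ ρ `1       = refl
    evalT-+ ρ (s `+ t) =
      trans (cong₂ _+_ (evalT-+ ρ s) (evalT-+ ρ t)) (sym (pos-+ (evalT (𝔑 p) ρ s) (evalT (𝔑 p) ρ t)))

    relativise⇒ : ∀ {n} (ρ : Vec ℕ n) φ → Sat (ℨ p) (map +_ ρ) (relativise φ) → Sat (𝔑 p) ρ φ
    relativise⇐ : ∀ {n} (ρ : Vec ℕ n) φ → Sat (𝔑 p) ρ φ → Sat (ℨ p) (map +_ ρ) (relativise φ)
    relativise⇒ ρ (s `≈ t) h = cong ℤ.∣_∣ (trans (sym (evalT-+ ρ s)) (trans h (evalT-+ ρ t)))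
    relativise⇒ ρ (rel R (s ∷ t ∷ [])) h =
      divₚ-ℤ⇒ℕ _ _ (subst₂ (∣ₚℤ p) (evalT-+ ρ s) (evalT-+ ρ t) h)
    relativise⇒ ρ (φ `∧ ψ) (h₁ , h₂) = relativise⇒ ρ φ h₁ , relativise⇒ ρ ψ h₂
    relativise⇒ ρ (φ `∨ ψ) (inj₁ h)  = inj₁ (relativise⇒ ρ φ h)
    relativise⇒ ρ (φ `∨ ψ) (inj₂ h)  = inj₂ (relativise⇒ ρ ψ h)
    relativise⇒ ρ (`∃ φ) (.(+ n) , +≤+ {n = n} _ , h) = n , relativise⇒ (n ∷ ρ) φ h
    relativise⇐ ρ (s `≈ t) h = trans (evalT-+ ρ s) (trans (cong +_ h) (sym (evalT-+ ρ t)))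
    relativise⇐ ρ (rel R (s ∷ t ∷ [])) h =
      subst₂ (∣ₚℤ p) (sym (evalT-+ ρ s)) (sym (evalT-+ ρ t)) (divₚ-ℕ⇒ℤ _ _ h)
    relativise⇐ ρ (φ `∧ ψ) (h₁ , h₂) = relativise⇐ ρ φ h₁ , relativise⇐ ρ ψ h₂
    relativise⇐ ρ (φ `∨ ψ) (inj₁ h)  = inj₁ (relativise⇐ ρ φ h)
    relativise⇐ ρ (φ `∨ ψ) (inj₂ h)  = inj₂ (relativise⇐ ρ ψ h)
    relativise⇐ ρ (`∃ φ) (n , h) = + n , +≤+ z≤n , relativise⇐ (n ∷ ρ) φ h

  -- Writing a = A - A′ and b = B - B′ with A, A′, B, B′ ≥ 0,
  --   a·b + A·B′ + A′·B = A·B + A′·B′,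
  -- which reduces multiplication of integers to four multiplications in ℕ.
  cross-terms : ∀ a b A′ B′ {A B} → a + A′ ≡ A → b + B′ ≡ B →
                a * b + A * B′ + A′ * B ≡ A * B + A′ * B′
  cross-terms a b A′ B′ refl refl = expand a b A′ B′
    where
      expand : ∀ a b A′ B′ → a * b + (a + A′) * B′ + A′ * (b + B′)
               ≡ (a + A′) * (b + B′) + A′ * B′
      expand = solve-∀

  as-difference : ∀ a → Σ ℕ λ A → Σ ℕ λ A′ → a + + A′ ≡ + A
  as-difference (+ n)    = n , 0 , ℤP.+-identityʳ (+ n)
  as-difference -[1+ n ] = 0 , suc n , ℤP.+-inverseˡ (+ suc n)

  μ₁⁺ : ∀ {n} → Term n → Term n → Term n → PEFormula LangZ n
  μ₁⁺ x y z = subF (x ∷ y ∷ z ∷ []) (relativise μ₁)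

  -- μ₂(a, b, c):  ∃ A A′ B B′ X₁ X₂ X₃ X₄ ≥ 0.  a + A′ = A ∧ b + B′ = B
  --   ∧ X₁ = A·B ∧ X₂ = A·B′ ∧ X₃ = A′·B ∧ X₄ = A′·B′ ∧ c + X₂ + X₃ = X₁ + X₄.
  μ₂ : PEFormula LangZ 3
  μ₂ = ∃⁺ⁿ 8 (((v 8 `+ v 6) `≈ v 7)
    `∧ (((v 9 `+ v 4) `≈ v 5)
    `∧ (μ₁⁺ (v 7) (v 5) (v 3)
    `∧ (μ₁⁺ (v 7) (v 4) (v 2)
    `∧ (μ₁⁺ (v 6) (v 5) (v 1)
    `∧ (μ₁⁺ (v 6) (v 4) (v 0)
    `∧ (((v 10 `+ v 2) `+ v 1) `≈ (v 3 `+ v 0))))))))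

  module Semanticsℨ (q : ℕ) where
    open PowersOf q using (p)
    open Semantics𝔑 q using (μ₁-sound; μ₁-complete)
    open Relativisation p
    open SubstitutionLemma (ℨ p)

    μ₁⁺-sound : ∀ {n} (ρ : Vec ℤ n) x y z {X Y Z} →
                evalTs (ℨ p) ρ (x ∷ y ∷ z ∷ []) ≡ map +_ (X ∷ Y ∷ Z ∷ []) →
                Sat (ℨ p) ρ (μ₁⁺ x y z) → + Z ≡ + X * + Y
    μ₁⁺-sound ρ x y z {X} {Y} {Z} e h = trans (cong +_ (μ₁-sound X Y Z (relativise⇒ (X ∷ Y ∷ Z ∷ []) μ₁
      (subst (λ σ → Sat (ℨ p) σ (relativise μ₁)) e (subF⇒ ρ (x ∷ y ∷ z ∷ []) (relativise μ₁) h)))))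
      (pos-* X Y)

    μ₂-sound : ∀ a b c → Sat (ℨ p) (a ∷ b ∷ c ∷ []) μ₂ → c ≡ a * b
    μ₂-sound a b c
      ( .(+ A)  , +≤+ {n = A}  _ , .(+ A′) , +≤+ {n = A′} _
      , .(+ B)  , +≤+ {n = B}  _ , .(+ B′) , +≤+ {n = B′} _
      , .(+ X₁) , +≤+ {n = X₁} _ , .(+ X₂) , +≤+ {n = X₂} _
      , .(+ X₃) , +≤+ {n = X₃} _ , .(+ X₄) , +≤+ {n = X₄} _
      , a+A′≡A , b+B′≡B , h₁ , h₂ , h₃ , h₄ , c+X₂+X₃≡X₁+X₄) =
      +-cancelʳ (+ A * + B′) (+-cancelʳ (+ A′ * + B) (begin
        c + + A * + B′ + + A′ * + B        ≡⟨ cong₂ (λ s t → c + s + t) (sym X₂≡) (sym X₃≡) ⟩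
        c + + X₂ + + X₃                    ≡⟨ c+X₂+X₃≡X₁+X₄ ⟩
        + X₁ + + X₄                        ≡⟨ cong₂ _+_ X₁≡ X₄≡ ⟩
        + A * + B + + A′ * + B′            ≡⟨ cross-terms a b (+ A′) (+ B′) a+A′≡A b+B′≡B ⟨
        a * b + + A * + B′ + + A′ * + B    ∎))
      where
        open ≡-Reasoning
        ρ = + X₄ ∷ + X₃ ∷ + X₂ ∷ + X₁ ∷ + B′ ∷ + B ∷ + A′ ∷ + A ∷ a ∷ b ∷ c ∷ []
        X₁≡ = μ₁⁺-sound ρ (v 7) (v 5) (v 3) refl h₁
        X₂≡ = μ₁⁺-sound ρ (v 7) (v 4) (v 2) refl h₂
        X₃≡ = μ₁⁺-sound ρ (v 6) (v 5) (v 1) refl h₃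
        X₄≡ = μ₁⁺-sound ρ (v 6) (v 4) (v 0) refl h₄

    μ₂-complete : ∀ a b → Sat (ℨ p) (a ∷ b ∷ a * b ∷ []) μ₂
    μ₂-complete a b with as-difference a | as-difference b
    ... | A , A′ , a+A′≡A | B , B′ , b+B′≡B =
        + A , +≤+ z≤n , + A′ , +≤+ z≤n , + B , +≤+ z≤n , + B′ , +≤+ z≤n
      , + (A ℕ.* B) , +≤+ z≤n , + (A ℕ.* B′) , +≤+ z≤n
      , + (A′ ℕ.* B) , +≤+ z≤n , + (A′ ℕ.* B′) , +≤+ z≤n
      , a+A′≡A , b+B′≡B
      , product (v 7) (v 5) (v 3) A B refl
      , product (v 7) (v 4) (v 2) A B′ refl
      , product (v 6) (v 5) (v 1) A′ B refl
      , product (v 6) (v 4) (v 0) A′ B′ refl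
      , (begin
        a * b + + (A ℕ.* B′) + + (A′ ℕ.* B)   ≡⟨ cong₂ (λ s t → a * b + s + t) (pos-* A B′) (pos-* A′ B) ⟩
        a * b + + A * + B′ + + A′ * + B       ≡⟨ cross-terms a b (+ A′) (+ B′) a+A′≡A b+B′≡B ⟩
        + A * + B + + A′ * + B′               ≡⟨ cong₂ _+_ (pos-* A B) (pos-* A′ B′) ⟨
        + (A ℕ.* B) + + (A′ ℕ.* B′)           ∎)
      where
        open ≡-Reasoning
        ρ = + (A′ ℕ.* B′) ∷ + (A′ ℕ.* B) ∷ + (A ℕ.* B′) ∷ + (A ℕ.* B)
          ∷ + B′ ∷ + B ∷ + A′ ∷ + A ∷ a ∷ b ∷ a * b ∷ []
        product : ∀ x y z X Y → evalTs (ℨ p) ρ (x ∷ y ∷ z ∷ []) ≡ map +_ (X ∷ Y ∷ X ℕ.* Y ∷ []) →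
                  Sat (ℨ p) ρ (μ₁⁺ x y z)
        product x y z X Y e = subF⇐ ρ (x ∷ y ∷ z ∷ []) (relativise μ₁)
          (subst (λ σ → Sat (ℨ p) σ (relativise μ₁)) (sym e)
            (relativise⇐ (X ∷ Y ∷ X ℕ.* Y ∷ []) μ₁ (μ₁-complete X Y)))

module IntegersWithDivisibility where

  open import Defs
  open Substitution
  open Naturals using (rep; quo; repunit-value; repunit-residue; module PowersOf; module Semantics𝔑)
  open Integers using (module DivₚEmbedding; +-cancelʳ)
  open import Data.Nat as ℕ using (ℕ; zero; suc; _≤_; _<_; z≤n; s≤s; NonZero)
  import Data.Nat.Properties as ℕP
  import Data.Nat.Divisibility as ℕD
  open import Data.Nat.DivMod using (_%_; _/_; m%n<n; m≡m%n+[m/n]*n)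
  open import Data.Integer as ℤ using (ℤ; +_; -[1+_]; ∣_∣; -_; _+_; _-_; _*_; 0ℤ; 1ℤ)
  import Data.Integer.Properties as ℤP
  open import Data.Integer.Divisibility.Signed
    using (_∣_; divides; ∣ᵤ⇒∣; ∣⇒∣ᵤ; ∣-refl; ∣-trans; ∣m∣n⇒∣m+n; ∣m⇒∣-m; ∣n⇒∣m*n; ∣m⇒∣m*n; *-monoˡ-∣; *-cancelʳ-∣)
  open import Data.Integer.DivMod using (_%ℕ_; _/ℕ_; a≡a%ℕn+[a/ℕn]*n)
  open import Data.Integer.Tactic.RingSolver using (solve-∀)
  import Data.Nat.Tactic.RingSolver as ℕ-Solver
  open import Data.Fin using (Fin; toℕ; fromℕ<)
  open import Data.Vec using ([]; _∷_)
  open import Data.Fin.Properties using (pigeonhole; toℕ-fromℕ<)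
  open import Data.Product using (Σ; _×_; _,_; proj₁; proj₂)
  open import Data.Sum as Sum using (_⊎_; inj₁; inj₂)
  open import Data.Empty using (⊥-elim)
  open import Relation.Nullary using (¬_; yes; no)
  open import Relation.Binary.PropositionalEquality

  ℕ-small-multiple : ∀ {d x} → d ℕD.∣ x → x < d → x ≡ 0
  ℕ-small-multiple {x = zero}  _   _   = refl
  ℕ-small-multiple {x = suc x} d∣x x<d = ⊥-elim (ℕP.<-irrefl refl (ℕP.<-≤-trans x<d (ℕD.∣⇒≤ d∣x)))

  small-multiple : ∀ {U x} → U ∣ x → (U ≡ 0ℤ ⊎ ∣ x ∣ < ∣ U ∣) → x ≡ 0ℤ
  small-multiple (divides q refl) (inj₁ refl) = ℤP.*-zeroʳ q
  small-multiple U∣x (inj₂ |x|<|U|) = ℤP.∣i∣≡0⇒i≡0 (ℕ-small-multiple (∣⇒∣ᵤ U∣x) |x|<|U|)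

  -- Undoing the successor steps that the formulas below use in place of
  -- subtraction.
  infix 25 _+3ℤ
  _+3ℤ : ℤ → ℤ
  z +3ℤ = ((z + 1ℤ) + 1ℤ) + 1ℤ

  back-1 : ∀ z → z ≡ (z + 1ℤ) - 1ℤ
  back-1 = solve-∀

  back-2 : ∀ {z y} → (z + 1ℤ) + 1ℤ ≡ y → z ≡ y - + 2
  back-2 {z} refl = undo z
    where
      undo : ∀ z → z ≡ ((z + 1ℤ) + 1ℤ) - + 2
      undo = solve-∀

  back-3 : ∀ z {y} → z +3ℤ ≡ y → z ≡ y - + 3
  back-3 z refl = undo z
    where
      undo : ∀ z → z ≡ (((z + 1ℤ) + 1ℤ) + 1ℤ) - + 3
      undo = solve-∀

  difference-of-naturals : ∀ {E m n} → E + + n ≡ + m → n ≤ m → E ≡ + (m ℕ.∸ n)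
  difference-of-naturals {E} {m} {n} E+n≡m n≤m = begin
    E                  ≡⟨ back E (+ n) ⟩
    E + + n - + n      ≡⟨ cong (_- + n) E+n≡m ⟩
    + m - + n          ≡⟨ ℤP.m-n≡m⊖n m n ⟩
    m ℤ.⊖ n            ≡⟨ ℤP.⊖-≥ n≤m ⟩
    + (m ℕ.∸ n)        ∎
    where
      open ≡-Reasoning
      back : ∀ E n → E ≡ E + n - n
      back = solve-∀

  mod-representative : ∀ x U .{{_ : NonZero U}} → + U ∣ x - + (x %ℕ U)
  mod-representative x U = divides (x /ℕ U)
    (trans (cong (_- + (x %ℕ U)) (a≡a%ℕn+[a/ℕn]*n x U)) (cancel (+ (x %ℕ U)) (x /ℕ U * + U)))
    where
      cancel : ∀ r t → r + t - r ≡ t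
      cancel = solve-∀

  -- Indeed Y = t·m with
  -- |t| < Z, and m - 1 divides Y - k - t·(m - 1) = t - k, where |t - k| < 2Z.
  pin-multiple : ∀ {k D Y : ℤ} {m Z : ℕ} → + m ∣ Y → + (m ℕ.∸ 1) ∣ D → D + k ≡ Y →
                 ∣ k ∣ < Z → ∣ Y ∣ < Z ℕ.* m → 1 ≤ m → (m ℕ.∸ 1 ≡ 0 ⊎ Z ℕ.+ Z ≤ m ℕ.∸ 1) →
                 Y ≡ k * + m
  pin-multiple {k} {D} {Y} {suc M} {Z} (divides t refl) M∣D D+k≡Y |k|<Z |Y|<Zm _ M≡0⊎2Z≤M =
    cong (_* + suc M) t≡k
    where
      open ≡-Reasoning
      t-k≡ : t - k ≡ D - t * + M
      t-k≡ = begin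
        t - k                        ≡⟨ rearrange t k (+ M) ⟩
        (t * + suc M - k) - t * + M    ≡⟨ cong (λ y → (y - k) - t * + M) D+k≡Y ⟨
        (D + k - k) - t * + M          ≡⟨ cancel D k (t * + M) ⟩
        D - t * + M                    ∎
        where
          rearrange : ∀ t k M → t - k ≡ (t * (1ℤ + M) - k) - t * M
          rearrange = solve-∀
          cancel : ∀ D k x → (D + k - k) - x ≡ D - x
          cancel = solve-∀
      M∣t-k : + M ∣ t - k
      M∣t-k = subst (+ M ∣_) (sym t-k≡) (∣m∣n⇒∣m+n M∣D (∣m⇒∣-m (∣n⇒∣m*n t (∣-refl {+ M}))))
      |t|<Z : ∣ t ∣ < Z
      |t|<Z = ℕP.*-cancelʳ-< (suc M) ∣ t ∣ Z (subst (_< Z ℕ.* suc M) (ℤP.abs-* t (+ suc M)) |Y|<Zm)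
      |t-k|<2Z : ∣ t - k ∣ < Z ℕ.+ Z
      |t-k|<2Z = ℕP.≤-<-trans (ℤP.∣i+j∣≤∣i∣+∣j∣ t (- k))
                   (ℕP.+-mono-< |t|<Z (subst (_< Z) (sym (ℤP.∣-i∣≡∣i∣ k)) |k|<Z))
      t≡k : t ≡ k
      t≡k = ℤP.i-j≡0⇒i≡j t k (small-multiple M∣t-k (Sum.map (cong (+_)) (ℕP.<-≤-trans |t-k|<2Z) M≡0⊎2Z≤M))

  nonunit-≥2 : ∀ {n} → 2 ≤ n → NonUnitNonZero (+ n)
  nonunit-≥2 {suc (suc n)} _ = (λ ()) , (λ ()) , (λ ())
  nonunit-≥2 {suc zero} (s≤s ())

  far-from-units : ∀ y z → NonUnitNonZero y → z +3ℤ ≡ y → NonUnitNonZero z → NonUnitNonZero (y +3ℤ) → 5 ≤ ∣ y ∣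
  far-from-units (+ 0) z (_ , y≢0 , _) _ _ _ = ⊥-elim (y≢0 refl)
  far-from-units (+ 1) z (_ , _ , y≢1) _ _ _ = ⊥-elim (y≢1 refl)
  far-from-units (+ 2) z _ e (z≢-1 , _ , _) _ = ⊥-elim (z≢-1 (back-3 z e))
  far-from-units (+ 3) z _ e (_ , z≢0 , _)  _ = ⊥-elim (z≢0 (back-3 z e))
  far-from-units (+ 4) z _ e (_ , _ , z≢1)  _ = ⊥-elim (z≢1 (back-3 z e))
  far-from-units (+ suc (suc (suc (suc (suc k))))) _ _ _ _ _ = s≤s (s≤s (s≤s (s≤s (s≤s z≤n))))
  far-from-units -[1+ 0 ] z (y≢-1 , _ , _) _ _ _ = ⊥-elim (y≢-1 refl)
  far-from-units -[1+ 1 ] z _ _ _ (_ , _ , t≢1)  = ⊥-elim (t≢1 refl)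
  far-from-units -[1+ 2 ] z _ _ _ (_ , t≢0 , _)  = ⊥-elim (t≢0 refl)
  far-from-units -[1+ 3 ] z _ _ _ (t≢-1 , _ , _) = ⊥-elim (t≢-1 refl)
  far-from-units -[1+ suc (suc (suc (suc k))) ] _ _ _ _ _ = s≤s (s≤s (s≤s (s≤s (s≤s z≤n))))

  -- From d + 1 = y ≠ 0 with d ∣ e and y + 1 ∣ e we get |y| - 1 ∣ |e|:
  -- one of d, y + 1 has absolute value |y| - 1.
  abs-pred-divides : ∀ y d e → NonUnitNonZero y → d + 1ℤ ≡ y → ∣ d ∣ ℕD.∣ ∣ e ∣ → ∣ y + 1ℤ ∣ ℕD.∣ ∣ e ∣ →
                     (∣ y ∣ ℕ.∸ 1) ℕD.∣ ∣ e ∣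
  abs-pred-divides (+ zero) d e (_ , y≢0 , _) _ _ _ = ⊥-elim (y≢0 refl)
  abs-pred-divides (+ suc Y) d e _ d+1≡y d∣e _ = subst (ℕD._∣ ∣ e ∣) (cong ∣_∣ (+1-injective d+1≡y)) d∣e
    where
      +1-injective : d + 1ℤ ≡ + suc Y → d ≡ + Y
      +1-injective h = trans (back-1 d) (cong (_- 1ℤ) h)
  abs-pred-divides -[1+ Y ] d e _ _ _ y+1∣e = subst (ℕD._∣ ∣ e ∣) (abs-neg+1 Y) y+1∣e
    where
      abs-neg+1 : ∀ n → ∣ -[1+ n ] + 1ℤ ∣ ≡ n
      abs-neg+1 zero    = refl
      abs-neg+1 (suc n) = refl

  at-least-4 : ∀ {g g₂} → 1 ≤ g → (g₂ + 1ℤ) + 1ℤ ≡ + g → NonUnitNonZero g₂ → 4 ≤ g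
  at-least-4 {suc zero}             _ e (g₂≢-1 , _ , _) = ⊥-elim (g₂≢-1 (back-2 e))
  at-least-4 {suc (suc zero)}       _ e (_ , g₂≢0 , _)  = ⊥-elim (g₂≢0 (back-2 e))
  at-least-4 {suc (suc (suc zero))} _ e (_ , _ , g₂≢1)  = ⊥-elim (g₂≢1 (back-2 e))
  at-least-4 {suc (suc (suc (suc g)))} _ _ _ = s≤s (s≤s (s≤s (s≤s z≤n)))

  room : ∀ {Z g} → 1 ≤ Z → 4 ≤ g → Z ℕ.* Z ℕ.+ Z ℕ.* Z ≤ Z ℕ.* Z ℕ.* g ℕ.∸ 1
  room {Z} {g} 1≤Z 4≤g = ℕP.m+n≤o⇒m≤o∸n (Z² ℕ.+ Z²) (begin
    Z² ℕ.+ Z² ℕ.+ 1           ≤⟨ ℕP.+-monoʳ-≤ (Z² ℕ.+ Z²) (ℕP.≤-trans 1≤Z² (ℕP.m≤m+n Z² Z²)) ⟩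
    Z² ℕ.+ Z² ℕ.+ (Z² ℕ.+ Z²) ≡⟨ four-times Z² ⟩
    Z² ℕ.* 4                  ≤⟨ ℕP.*-monoʳ-≤ Z² 4≤g ⟩
    Z² ℕ.* g                  ∎)
    where
      open ℕP.≤-Reasoning
      Z² = Z ℕ.* Z
      1≤Z² : 1 ≤ Z²
      1≤Z² = ℕP.*-mono-≤ 1≤Z 1≤Z
      four-times : ∀ x → x ℕ.+ x ℕ.+ (x ℕ.+ x) ≡ x ℕ.* 4
      four-times = ℕ-Solver.solve-∀

  product-from-congruence : ∀ {a b c : ℤ} {Z U : ℕ} → + U ∣ c - a * b →
    ∣ a ∣ < Z → ∣ b ∣ < Z → ∣ c ∣ < Z ℕ.* Z → Z ℕ.* Z ℕ.+ Z ℕ.* Z ≤ U → c ≡ a * b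
  product-from-congruence {a} {b} {c} {Z} {U} U∣c-ab |a|<Z |b|<Z |c|<Z² 2Z²≤U =
    ℤP.i-j≡0⇒i≡j c (a * b) (small-multiple U∣c-ab (inj₂ (ℕP.<-≤-trans |c-ab|<2Z² 2Z²≤U)))
    where
      |c-ab|<2Z² : ∣ c - a * b ∣ < Z ℕ.* Z ℕ.+ Z ℕ.* Z
      |c-ab|<2Z² = ℕP.≤-<-trans (ℤP.∣i+j∣≤∣i∣+∣j∣ c (- (a * b)))
        (ℕP.+-mono-< |c|<Z² (subst (_< Z ℕ.* Z) (sym (trans (ℤP.∣-i∣≡∣i∣ (a * b)) (ℤP.abs-* a b)))
                                    (ℕP.*-mono-< |a|<Z |b|<Z)))

  record RepWitness (k U e : ℤ) : Set where
    constructor witness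
    field
      r     : ℤ
      e≡r·U : e ≡ r * U
      U∣r-k : U ∣ r - k

  -- As in ℕ: from V = R₁U, W = R₂V = R₃U with R₁ ≡ a, R₃ ≡ c (mod U) and
  -- R₂ ≡ b (mod V) we get R₃ = R₂R₁, hence c ≡ ab (mod U).
  repunit-product-ℤ : ∀ {a b c U V W} .{{_ : ℤ.NonZero U}} →
    RepWitness a U V → RepWitness b V W → RepWitness c U W → U ∣ c - a * b
  repunit-product-ℤ {a} {b} {c} {U}
    (witness R₁ V≡R₁U U∣R₁-a) (witness R₂ W≡R₂V V∣R₂-b) (witness R₃ W≡R₃U U∣R₃-c) =
    subst (U ∣_) (sym c-ab≡)
      (∣m∣n⇒∣m+n (∣m⇒∣-m U∣R₃-c) (∣m∣n⇒∣m+n (∣m⇒∣m*n R₂ U∣R₁-a) (∣n⇒∣m*n a U∣R₂-b)))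
    where
      open ≡-Reasoning
      U∣R₂-b : U ∣ R₂ - b
      U∣R₂-b = ∣-trans (divides R₁ V≡R₁U) V∣R₂-b
      R₃≡R₂R₁ : R₃ ≡ R₂ * R₁
      R₃≡R₂R₁ = ℤP.*-cancelʳ-≡ R₃ (R₂ * R₁) U (begin
        R₃ * U         ≡⟨ W≡R₃U ⟨
        _              ≡⟨ W≡R₂V ⟩
        R₂ * _         ≡⟨ cong (R₂ *_) V≡R₁U ⟩
        R₂ * (R₁ * U)  ≡⟨ ℤP.*-assoc R₂ R₁ U ⟨
        R₂ * R₁ * U    ∎)
      c-ab≡ : c - a * b ≡ - (R₃ - c) + ((R₁ - a) * R₂ + a * (R₂ - b))
      c-ab≡ = trans (rearrange a b c R₁ R₂) (cong (λ x → - (x - c) + ((R₁ - a) * R₂ + a * (R₂ - b))) (sym R₃≡R₂R₁))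
        where
          rearrange : ∀ a b c R₁ R₂ → c - a * b ≡ - (R₂ * R₁ - c) + ((R₁ - a) * R₂ + a * (R₂ - b))
          rearrange = solve-∀

  factor : ∀ r k U → (r - k) * U ≡ r * U - k * U
  factor = solve-∀

  -- RepWitness k U e is equivalent to the divisibilities  U ∣ e  and
  -- U² ∣ e - k·U  (for U = 0 both say e = 0).
  rep-witness-from : ∀ {k e E U} → U ∣ e → U * U ∣ E → E + k * U ≡ e → RepWitness k U e
  rep-witness-from {k} {e} {E} {U} (divides r e≡rU) UU∣E E+kU≡e with U ℤP.≟ 0ℤ
  ... | yes refl = witness k (trans e≡rU (trans (ℤP.*-zeroʳ r) (sym (ℤP.*-zeroʳ k))))
                             (divides 0ℤ (ℤP.+-inverseʳ k))
  ... | no U≢0 = witness r e≡rU (*-cancelʳ-∣ U {{ℤ.≢-nonZero U≢0}} (subst (U * U ∣_) E≡ UU∣E))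
    where
      E≡ : E ≡ (r - k) * U
      E≡ = begin
        E                  ≡⟨ back E (k * U) ⟩
        E + k * U - k * U  ≡⟨ cong (_- k * U) (trans E+kU≡e e≡rU) ⟩
        r * U - k * U      ≡⟨ factor r k U ⟨
        (r - k) * U        ∎
        where
          open ≡-Reasoning
          back : ∀ E x → E ≡ E + x - x
          back = solve-∀

  rep-witness-to : ∀ {k e U} → RepWitness k U e → U * U ∣ e - k * U
  rep-witness-to {k} {e} {U} (witness r refl U∣r-k) =
    subst (U * U ∣_) (factor r k U) (*-monoˡ-∣ U U∣r-k)

  power-RepWitness : ∀ {k} u n → 1 ≤ u → + (u ℕ.∸ 1) ∣ k - + n →
                     RepWitness k (+ (u ℕ.∸ 1)) (+ (u ℕ.^ n ℕ.∸ 1))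
  power-RepWitness {k} (suc U) n _ U∣k-n =
    witness (+ rep (suc U) n)
      (trans (cong (+_) (repunit-value U n)) (ℤP.pos-* (rep (suc U) n) U))
      (subst (+ U ∣_) (sym rep-k≡) (∣m∣n⇒∣m+n (∣n⇒∣m*n (+ quo (suc U) n) (∣-refl {+ U}))
                                               (∣m⇒∣-m U∣k-n)))
    where
      rep-k≡ : + rep (suc U) n - k ≡ + quo (suc U) n * + U + - (k - + n)
      rep-k≡ = trans (cong (λ r → + r - k) (repunit-residue U n))
        (trans (cong (_- k) (trans (ℤP.pos-+ n _) (cong (λ x → + n + x) (ℤP.pos-* (quo (suc U) n) U))))
          (rearrange (+ n) (+ quo (suc U) n) (+ U) k))
        where
          rearrange : ∀ n q U k → (n + q * U) - k ≡ q * U + - (k - n)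
          rearrange = solve-∀

  square-of-successor : ∀ M → + (suc M ℕ.* suc M) + 1ℤ ≡ (+ M * + M + + suc M) + + suc M
  square-of-successor M = trans (cong (_+ 1ℤ) (ℤP.pos-* (suc M) (suc M))) (expand (+ M))
    where
      expand : ∀ M → (1ℤ + M) * (1ℤ + M) + 1ℤ ≡ (M * M + (1ℤ + M)) + (1ℤ + M)
      expand = solve-∀

  ∣∸-of-%≡ : ∀ x y n .{{_ : NonZero n}} → x % n ≡ y % n → n ℕD.∣ y ℕ.∸ x
  ∣∸-of-%≡ x y n e = ℕD.divides (y / n ℕ.∸ x / n) (begin
    y ℕ.∸ x                                         ≡⟨ cong₂ ℕ._∸_ (m≡m%n+[m/n]*n y n) (m≡m%n+[m/n]*n x n) ⟩
    (y % n ℕ.+ y / n ℕ.* n) ℕ.∸ (x % n ℕ.+ x / n ℕ.* n) ≡⟨ cong (λ r → (y % n ℕ.+ y / n ℕ.* n) ℕ.∸ (r ℕ.+ x / n ℕ.* n)) e ⟩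
    (y % n ℕ.+ y / n ℕ.* n) ℕ.∸ (y % n ℕ.+ x / n ℕ.* n) ≡⟨ ℕP.[m+n]∸[m+o]≡n∸o (y % n) _ _ ⟩
    y / n ℕ.* n ℕ.∸ x / n ℕ.* n                     ≡⟨ ℕP.*-distribʳ-∸ n (y / n) (x / n) ⟨
    (y / n ℕ.∸ x / n) ℕ.* n                         ∎)
    where open ≡-Reasoning

  -- Pigeonhole: among X⁰, …, Xⁿ two are congruent modulo n ≥ 1, so
  -- n ∣ Xʲ - Xⁱ for some i < j.
  powers-collide : ∀ X n .{{_ : NonZero n}} → Σ ℕ λ i → Σ ℕ λ j → (i < j) × (n ℕD.∣ X ℕ.^ j ℕ.∸ X ℕ.^ i)
  powers-collide X (suc n) with pigeonhole (ℕP.n<1+n (suc n)) residue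
    where
      residue : Fin (suc (suc n)) → Fin (suc n)
      residue k = fromℕ< (m%n<n (X ℕ.^ toℕ k) (suc n))
  ... | i , j , i<j , same = toℕ i , toℕ j , i<j ,
    ∣∸-of-%≡ (X ℕ.^ toℕ i) (X ℕ.^ toℕ j) (suc n)
      (trans (sym (toℕ-fromℕ< (m%n<n (X ℕ.^ toℕ i) (suc n))))
             (trans (cong toℕ same) (toℕ-fromℕ< (m%n<n (X ℕ.^ toℕ j) (suc n)))))

  _∣′_ : ∀ {n} → Term n → Term n → PEFormula LangD n
  x ∣′ y = rel dvd (x ∷ y ∷ [])

  divₚ : ∀ {n} → Term n → Term n → PEFormula LangD n
  divₚ x y = rel R (x ∷ y ∷ [])

  nonunit : ∀ {n} → Term n → PEFormula LangD n
  nonunit x = rel T (x ∷ [])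

  infix 25 _+3
  _+3 : ∀ {n} → Term n → Term n
  x +3 = ((x `+ `1) `+ `1) `+ `1

  -- PosPow(x): "x is a positive power of p", expressed as
  --   1 |ₚ x ∧ ∃ y e z d.  1 |ₚ y ∧ y, y - 3, y + 3 ∉ {-1, 0, 1}
  --     ∧ e = x - 1 ∧ d = y - 1 ∧ d ∣ e ∧ y + 1 ∣ e.
  -- So x = ±pʳ and |y| = pˢ ≥ 5 with pˢ - 1 ∣ x - 1, which excludes x = -pʳ.
  PosPow : PEFormula LangD 1
  PosPow = divₚ `1 (v 0) `∧ ∃ⁿ 4 (
       divₚ `1 (v 3)
    `∧ (nonunit (v 3)
    `∧ (((v 1) +3 `≈ v 3)
    `∧ (nonunit (v 1)
    `∧ (nonunit ((v 3) +3)
    `∧ (((v 2 `+ `1) `≈ v 4)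
    `∧ (((v 0 `+ `1) `≈ v 3)
    `∧ ((v 0 ∣′ v 2)
    `∧ ((v 3 `+ `1) ∣′ v 2)))))))))

  posPow : ∀ {n} → Term n → PEFormula LangD n
  posPow x = subF (x ∷ []) PosPow

  -- MulPowD(a, u, y):  a |ₚ y ∧ a ∣ y ∧ a+1 |ₚ y+u ∧ a+1 ∣ y+u ∧ a+2 |ₚ y+2u ∧ a+2 ∣ y+2u.
  -- For a ≥ 0, y > 0 and u a power of p this says y = a·u (divisibility
  -- replaces the inequality a ≤ y of MulPow).
  MulPowD : PEFormula LangD 3
  MulPowD = divₚ (v 0) (v 2) `∧ ((v 0 ∣′ v 2)
    `∧ (divₚ (v 0 `+ `1) (v 2 `+ v 1) `∧ (((v 0 `+ `1) ∣′ (v 2 `+ v 1))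
    `∧ (divₚ ((v 0 `+ `1) `+ `1) ((v 2 `+ v 1) `+ v 1)
    `∧ (((v 0 `+ `1) `+ `1) ∣′ ((v 2 `+ v 1) `+ v 1))))))

  mulPowD : ∀ {n} → Term n → Term n → Term n → PEFormula LangD n
  mulPowD a u y = subF (a ∷ u ∷ y ∷ []) MulPowD

  -- Small(x, z):  x = 0 ∨ ∃ W P E.  PosPow(W) ∧ PosPow(P) ∧ E + P = W ∧ E ∉ {-1,0,1}
  --   ∧ x ∣ E ∧ W ∣ z ∧ P ∣ W,
  -- so that |x| ≤ E < W ≤ z.
  Small : PEFormula LangD 2
  Small = (v 0 `≈ `0) `∨ ∃ⁿ 3 (
       posPow (v 2)
    `∧ (posPow (v 1)
    `∧ (((v 0 `+ v 1) `≈ v 2)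
    `∧ (nonunit (v 0)
    `∧ ((v 3 ∣′ v 0)
    `∧ ((v 2 ∣′ v 4)
    `∧ (v 1 ∣′ v 2)))))))

  small : ∀ {n} → Term n → Term n → PEFormula LangD n
  small x z = subF (x ∷ z ∷ []) Small

  -- RepD(k, z, u, e):  ∃ zu U₂ Sq U Y D E.
  --   PosPow(zu) ∧ zu = z·u ∧ PosPow(U₂) ∧ U₂ = u·u ∧ U + 1 = u ∧ Sq + 2u = U₂ + 1
  --   ∧ Small(Y, zu) ∧ D + k = Y ∧ u ∣ Y ∧ U ∣ D ∧ U ∣ e ∧ E + D = e ∧ Sq ∣ E.
  -- For z, u powers of p with |k| < z and 2z ≤ u - 1 this pins down
  -- Y = k·u, D = k·U, Sq = U², so that it says  U ∣ e  and  U² ∣ e - k·U,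
  -- i.e. e is a RepWitness for k modulo U = u - 1.
  RepD : PEFormula LangD 4
  RepD = ∃ⁿ 7 (posPow (v 6)
    `∧ (mulPowD (v 8) (v 9) (v 6)
    `∧ (posPow (v 5)
    `∧ (mulPowD (v 9) (v 9) (v 5)
    `∧ (((v 3 `+ `1) `≈ v 9)
    `∧ ((((v 4 `+ v 9) `+ v 9) `≈ (v 5 `+ `1))
    `∧ (small (v 2) (v 6)
    `∧ (((v 1 `+ v 7) `≈ v 2)
    `∧ ((v 9 ∣′ v 2)
    `∧ ((v 3 ∣′ v 1)
    `∧ ((v 3 ∣′ v 10)
    `∧ (((v 0 `+ v 1) `≈ v 10)
    `∧  (v 4 ∣′ v 0)))))))))))))

  repD : ∀ {n} → Term n → Term n → Term n → Term n → PEFormula LangD n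
  repD k z u e = subF (k ∷ z ∷ u ∷ e ∷ []) RepD

  -- μ₃(a, b, c):  ∃ z z₂ g g₂ u v V W.
  --   PosPow(z) ∧ PosPow(z₂) ∧ z₂ = z·z ∧ PosPow(g) ∧ g₂ + 2 = g ∧ g₂ ∉ {-1,0,1}
  --   ∧ PosPow(u) ∧ u = z₂·g ∧ PosPow(v) ∧ Small(a, z) ∧ Small(b, z) ∧ Small(c, z₂)
  --   ∧ V + 1 = v ∧ RepD(a, z, u, V) ∧ RepD(b, z, v, W) ∧ RepD(c, z₂, u, W).
  -- With U = u - 1 ≥ 2z²: V ≡ a·U, W ≡ b·V ≡ c·U modulo U², V², U², whence
  -- c ≡ ab (mod U) and so c = ab.
  μ₃ : PEFormula LangD 3
  μ₃ = ∃ⁿ 8 (posPow (v 7)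
    `∧ (posPow (v 6)
    `∧ (mulPowD (v 7) (v 7) (v 6)
    `∧ (posPow (v 5)
    `∧ ((((v 4 `+ `1) `+ `1) `≈ v 5)
    `∧ (nonunit (v 4)
    `∧ (posPow (v 3)
    `∧ (mulPowD (v 6) (v 5) (v 3)
    `∧ (posPow (v 2)
    `∧ (small (v 8) (v 7)
    `∧ (small (v 9) (v 7)
    `∧ (small (v 10) (v 6)
    `∧ (((v 1 `+ `1) `≈ v 2)
    `∧ (repD (v 8) (v 7) (v 3) (v 1)
    `∧ (repD (v 9) (v 7) (v 2) (v 0)
    `∧  repD (v 10) (v 6) (v 3) (v 0))))))))))))))))

  repD-arith : ∀ {k e Sq U Y D E : ℤ} {Z m : ℕ} → 1 ≤ m → ∣ k ∣ < Z →
    (m ℕ.∸ 1 ≡ 0 ⊎ Z ℕ.+ Z ≤ m ℕ.∸ 1) →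
    U + 1ℤ ≡ + m → (Sq + + m) + + m ≡ + (m ℕ.* m) + 1ℤ →
    ∣ Y ∣ < Z ℕ.* m → D + k ≡ Y → + m ∣ Y → U ∣ D → U ∣ e → E + D ≡ e → Sq ∣ E →
    RepWitness k (+ (m ℕ.∸ 1)) e
  repD-arith {k} {e} {Sq} {U} {Y} {D} {E} {Z} {suc M}
             1≤m |k|<Z bound U+1≡m Sq+2m≡ |Y|<Zm D+k≡Y m∣Y U∣D U∣e E+D≡e Sq∣E =
    rep-witness-from (subst (_∣ e) U≡M U∣e) (subst (_∣ E) Sq≡M² Sq∣E) (trans (cong (λ x → E + x) kM≡D) E+D≡e)
    where
      open ≡-Reasoning
      U≡M : U ≡ + M
      U≡M = trans (back-1 U) (cong (_- 1ℤ) U+1≡m)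
      Sq≡M² : Sq ≡ + M * + M
      Sq≡M² = +-cancelʳ (+ suc M) (+-cancelʳ (+ suc M) (trans Sq+2m≡ (square-of-successor M)))
      Y≡km : Y ≡ k * + suc M
      Y≡km = pin-multiple m∣Y (subst (_∣ D) U≡M U∣D) D+k≡Y |k|<Z |Y|<Zm 1≤m bound
      kM≡D : k * + M ≡ D
      kM≡D = begin
        k * + M                 ≡⟨ rearrange k (+ M) ⟩
        k * (1ℤ + + M) - k      ≡⟨ cong (_- k) Y≡km ⟨
        Y - k                   ≡⟨ cong (_- k) D+k≡Y ⟨
        D + k - k               ≡⟨ back D k ⟨
        D                       ∎
        where
          rearrange : ∀ k M → k * M ≡ k * (1ℤ + M) - k
          rearrange = solve-∀
          back : ∀ D k → D ≡ D + k - k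
          back = solve-∀

  module Semantics𝔇 (q : ℕ) where
    open PowersOf q using (p; pow-+; pow-≤)
    open Semantics𝔑 q using (unit-divₚ; mulPow-sound; mulPow-complete)
    open DivₚEmbedding p using (pow-+ℤ; divₚ-ℤ⇒ℕ; divₚ-ℕ⇒ℤ)
    open SubstitutionLemma (𝔇 p)

    abs-times-pow : ∀ x s → ∣ x * (+ p) ℤ.^ s ∣ ≡ ∣ x ∣ ℕ.* p ℕ.^ s
    abs-times-pow x s = trans (ℤP.abs-* x _) (cong (λ y → ∣ x ∣ ℕ.* ∣ y ∣) (pow-+ℤ s))

    abs-divₚ : ∀ {x y} → ∣ₚℤ p x y → ∣ₚℕ p ∣ x ∣ ∣ y ∣
    abs-divₚ {x} {y} (s , inj₁ e) = s , inj₁ (trans (cong ∣_∣ e) (abs-times-pow x s))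
    abs-divₚ {x} {y} (s , inj₂ (inj₁ e)) =
      s , inj₁ (trans (cong ∣_∣ e) (trans (ℤP.∣-i∣≡∣i∣ (x * (+ p) ℤ.^ s)) (abs-times-pow x s)))
    abs-divₚ {x} {y} (s , inj₂ (inj₂ (inj₁ e))) = s , inj₂ (trans (cong ∣_∣ e) (abs-times-pow y s))
    abs-divₚ {x} {y} (s , inj₂ (inj₂ (inj₂ e))) =
      s , inj₂ (trans (cong ∣_∣ e) (trans (ℤP.∣-i∣≡∣i∣ (y * (+ p) ℤ.^ s)) (abs-times-pow y s)))

    power-gap : ∀ s → 5 ≤ p ℕ.^ suc s → suc (suc (p ℕ.^ s)) < p ℕ.^ suc s
    power-gap s 5≤pˢ⁺¹ with 3 ℕ.≤? p ℕ.^ s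
    ... | yes 3≤x = ℕP.≤-trans (ℕP.+-monoˡ-≤ x 3≤x) (ℕP.+-monoʳ-≤ x (ℕP.m≤m+n x (q ℕ.* x)))
      where x = p ℕ.^ s
    ... | no 3≰x = ℕP.≤-trans (s≤s (s≤s (s≤s (ℕP.≤-pred (ℕP.≰⇒> 3≰x))))) 5≤pˢ⁺¹

    -- pˢ - 1 never divides pʳ + 1 once pˢ ≥ 5: writing r = t + k·s with t < s,
    -- pˢ - 1 ∣ p^(ks) - 1 gives pʳ + 1 ≡ pᵗ + 1 (mod pˢ - 1), and
    -- 0 < pᵗ + 1 < pˢ - 1.
    no-power-plus-one : ∀ s r → 5 ≤ p ℕ.^ s → ¬ (p ℕ.^ s ℕ.∸ 1) ℕD.∣ suc (p ℕ.^ r)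
    no-power-plus-one zero    r (s≤s ())
    no-power-plus-one (suc s′) r 5≤pˢ M∣pʳ+1 =
      ℕP.<-irrefl refl (ℕP.<-≤-trans pᵗ+1<M (ℕD.∣⇒≤ M∣pᵗ+1))
      where
        open ≡-Reasoning
        s = suc s′
        X = p ℕ.^ s
        M = X ℕ.∸ 1
        t = r % s
        k = r / s
        X≡sucM : X ≡ suc M
        X≡sucM = trans (sym (ℕP.m∸n+n≡m (ℕP.m^n>0 p s))) (ℕP.+-comm M 1)
        pʳ≡ : p ℕ.^ r ≡ p ℕ.^ t ℕ.* X ℕ.^ k
        pʳ≡ = begin
          p ℕ.^ r                      ≡⟨ cong (p ℕ.^_) (m≡m%n+[m/n]*n r s) ⟩
          p ℕ.^ (t ℕ.+ k ℕ.* s)        ≡⟨ pow-+ t (k ℕ.* s) ⟩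
          p ℕ.^ t ℕ.* p ℕ.^ (k ℕ.* s)  ≡⟨ cong (λ e → p ℕ.^ t ℕ.* p ℕ.^ e) (ℕP.*-comm k s) ⟩
          p ℕ.^ t ℕ.* p ℕ.^ (s ℕ.* k)  ≡⟨ cong (p ℕ.^ t ℕ.*_) (ℕP.^-*-assoc p s k) ⟨
          p ℕ.^ t ℕ.* X ℕ.^ k          ∎
        M∣Xᵏ-1 : M ℕD.∣ X ℕ.^ k ℕ.∸ 1
        M∣Xᵏ-1 = subst (λ x → M ℕD.∣ x ℕ.^ k ℕ.∸ 1) (sym X≡sucM) (ℕD.divides (rep (suc M) k) (repunit-value M k))
        split : suc (p ℕ.^ r) ≡ p ℕ.^ t ℕ.* (X ℕ.^ k ℕ.∸ 1) ℕ.+ suc (p ℕ.^ t)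
        split = begin
          suc (p ℕ.^ r)                                        ≡⟨ cong suc pʳ≡ ⟩
          suc (p ℕ.^ t ℕ.* X ℕ.^ k)                            ≡⟨ cong (λ x → suc (p ℕ.^ t ℕ.* x)) (ℕP.m∸n+n≡m (ℕP.m^n>0 X {{ℕP.m^n≢0 p s}} k)) ⟨
          suc (p ℕ.^ t ℕ.* (X ℕ.^ k ℕ.∸ 1 ℕ.+ 1))              ≡⟨ expand (p ℕ.^ t) (X ℕ.^ k ℕ.∸ 1) ⟩
          p ℕ.^ t ℕ.* (X ℕ.^ k ℕ.∸ 1) ℕ.+ suc (p ℕ.^ t)        ∎
          where
            expand : ∀ a K → suc (a ℕ.* (K ℕ.+ 1)) ≡ a ℕ.* K ℕ.+ suc a
            expand = ℕ-Solver.solve-∀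
        M∣pᵗ+1 : M ℕD.∣ suc (p ℕ.^ t)
        M∣pᵗ+1 = ℕD.∣m+n∣m⇒∣n (subst (M ℕD.∣_) split M∣pʳ+1) (ℕD.∣n⇒∣m*n (p ℕ.^ t) M∣Xᵏ-1)
        pᵗ+1<M : suc (p ℕ.^ t) < M
        pᵗ+1<M = ℕP.≤-trans (s≤s (s≤s (pow-≤ (ℕP.≤-pred (m%n<n r s)))))
                            (ℕP.∸-monoˡ-≤ 1 (power-gap s′ 5≤pˢ))

    posPow-sound : ∀ {x} → Sat (𝔇 p) (x ∷ []) PosPow → Σ ℕ λ r → x ≡ + (p ℕ.^ r)
    posPow-sound {x} (1∣x , y , e , z , d , 1∣y , y∉ , z+3≡y , z∉ , y+3∉ , e+1≡x , d+1≡y , d∣e , y+1∣e)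
      with unit-divₚ (abs-divₚ 1∣x) | unit-divₚ (abs-divₚ 1∣y)
    ... | r , |x|≡pʳ | s , |y|≡pˢ = r , nonnegative x |x|≡pʳ e+1≡x
      where
        5≤pˢ : 5 ≤ p ℕ.^ s
        5≤pˢ = subst (5 ≤_) |y|≡pˢ (far-from-units y z y∉ z+3≡y z∉ y+3∉)
        pˢ-1∣e : (p ℕ.^ s ℕ.∸ 1) ℕD.∣ ∣ e ∣
        pˢ-1∣e = subst (λ n → (n ℕ.∸ 1) ℕD.∣ ∣ e ∣) |y|≡pˢ (abs-pred-divides y d e y∉ d+1≡y d∣e y+1∣e)
        -- x = -pʳ would make |e| = |x - 1| = pʳ + 1 a multiple of pˢ - 1.
        nonnegative : ∀ x → ∣ x ∣ ≡ p ℕ.^ r → e + 1ℤ ≡ x → x ≡ + (p ℕ.^ r)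
        nonnegative (+ n)    |x|≡pʳ _      = cong (+_) |x|≡pʳ
        nonnegative -[1+ n ] 1+n≡pʳ e+1≡x =
          ⊥-elim (no-power-plus-one s r 5≤pˢ (subst ((p ℕ.^ s ℕ.∸ 1) ℕD.∣_) |e|≡ pˢ-1∣e))
          where
            |e|≡ : ∣ e ∣ ≡ suc (p ℕ.^ r)
            |e|≡ = trans (cong ∣_∣ (trans (back-1 e) (cong (_- 1ℤ) e+1≡x)))
                         (cong suc (trans (cong suc (ℕP.+-identityʳ n)) 1+n≡pʳ))

    -- The powers certified by PosPow: those of B = Q² with Q = p³.
    Q : ℕ
    Q = p ℕ.^ 3

    B : ℕ
    B = Q ℕ.* Q

    8≤Q : 8 ≤ Q
    8≤Q = ℕP.^-monoˡ-≤ 3 {2} {p} (s≤s (s≤s z≤n))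

    Bⁿ≡ : ∀ n → B ℕ.^ n ≡ p ℕ.^ (6 ℕ.* n)
    Bⁿ≡ n = trans (cong (ℕ._^ n) (sym (pow-+ 3 3))) (ℕP.^-*-assoc p 6 n)

    1≤Bⁿ : ∀ n → 1 ≤ B ℕ.^ n
    1≤Bⁿ n = subst (1 ≤_) (sym (Bⁿ≡ n)) (ℕP.m^n>0 p (6 ℕ.* n))

    instance
      B≢0 : NonZero B
      B≢0 = ℕP.m*n≢0 Q Q {{ℕP.m^n≢0 p 3}} {{ℕP.m^n≢0 p 3}}

    3≤B : 3 ≤ B
    3≤B = ℕP.≤-trans (s≤s (s≤s (s≤s z≤n))) (ℕP.*-mono-≤ 8≤Q 8≤Q)

    2≤B∸2 : 2 ≤ B ℕ.∸ 2
    2≤B∸2 = ℕP.∸-monoˡ-≤ 2 (ℕP.≤-trans (s≤s (s≤s (s≤s (s≤s z≤n)))) (ℕP.*-mono-≤ 8≤Q 8≤Q))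

    2≤Bᵏ∸1 : ∀ {k} → 1 ≤ k → 2 ≤ B ℕ.^ k ℕ.∸ 1
    2≤Bᵏ∸1 {k} 1≤k = ℕP.∸-monoˡ-≤ 1 (ℕP.≤-trans 3≤B (subst (_≤ B ℕ.^ k) (ℕP.*-identityʳ B) (ℕP.^-monoʳ-≤ B 1≤k)))

    unit-divₚ-power : ∀ k → ∣ₚℤ p 1ℤ (+ (p ℕ.^ k))
    unit-divₚ-power k = divₚ-ℕ⇒ℤ 1 (p ℕ.^ k) (k , inj₁ (sym (ℕP.*-identityˡ _)))

    pred∣pred-pow : ∀ x n → 1 ≤ x → (x ℕ.∸ 1) ℕD.∣ (x ℕ.^ n ℕ.∸ 1)
    pred∣pred-pow (suc X) n _ = ℕD.divides (rep (suc X) n) (repunit-value X n)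

    B-1≡ : B ℕ.∸ 1 ≡ (Q ℕ.∸ 1) ℕ.* (Q ℕ.+ 1)
    B-1≡ = difference-of-squares Q (ℕP.≤-trans (s≤s z≤n) 8≤Q)
      where
        difference-of-squares : ∀ x → 1 ≤ x → x ℕ.* x ℕ.∸ 1 ≡ (x ℕ.∸ 1) ℕ.* (x ℕ.+ 1)
        difference-of-squares (suc x) _ = expand x
          where
            expand : ∀ x → x ℕ.+ x ℕ.* suc x ≡ x ℕ.* (suc x ℕ.+ 1)
            expand = ℕ-Solver.solve-∀

    -- PosPow(Bⁿ), witnessed by y = Q: Q - 1 and Q + 1 divide B - 1 ∣ Bⁿ - 1.
    posPow-complete : ∀ n → Sat (𝔇 p) (+ (B ℕ.^ n) ∷ []) PosPow
    posPow-complete n =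
        subst (λ m → ∣ₚℤ p 1ℤ (+ m)) (sym (Bⁿ≡ n)) (unit-divₚ-power (6 ℕ.* n))
      , + Q , + (B ℕ.^ n ℕ.∸ 1) , + (Q ℕ.∸ 3) , + (Q ℕ.∸ 1)
      , unit-divₚ-power 3
      , nonunit-≥2 (ℕP.≤-trans (s≤s (s≤s z≤n)) 8≤Q)
      , cong (+_) (trans (plus-three (Q ℕ.∸ 3)) (ℕP.m∸n+n≡m (ℕP.≤-trans (s≤s (s≤s (s≤s z≤n))) 8≤Q)))
      , nonunit-≥2 (ℕP.∸-monoˡ-≤ 3 (ℕP.≤-trans (ℕP.m≤m+n 5 3) 8≤Q))
      , nonunit-≥2 (ℕP.≤-trans (s≤s (s≤s z≤n)) (ℕP.m≤m+n (((Q ℕ.+ 1) ℕ.+ 1)) 1))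
      , cong (+_) (ℕP.m∸n+n≡m (1≤Bⁿ n))
      , cong (+_) (ℕP.m∸n+n≡m (ℕP.≤-trans (s≤s z≤n) 8≤Q))
      , ℕD.∣-trans (ℕD.divides (Q ℕ.+ 1) (trans B-1≡ (ℕP.*-comm (Q ℕ.∸ 1) (Q ℕ.+ 1)))) B-1∣Bⁿ-1
      , ℕD.∣-trans (ℕD.divides (Q ℕ.∸ 1) B-1≡) B-1∣Bⁿ-1
      where
        plus-three : ∀ a → a ℕ.+ 1 ℕ.+ 1 ℕ.+ 1 ≡ a ℕ.+ 3
        plus-three = ℕ-Solver.solve-∀
        B-1∣Bⁿ-1 : (B ℕ.∸ 1) ℕD.∣ (B ℕ.^ n ℕ.∸ 1)
        B-1∣Bⁿ-1 = pred∣pred-pow B n (subst (1 ≤_) (ℕP.*-identityʳ B) (1≤Bⁿ 1))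

    -- MulPowD(a, u, y) reduces to MulPow in 𝔑ₚ: a ∣ y with y > 0 gives a ≤ y.
    mulPowD-sound : ∀ {A s B} → 1 ≤ B → Sat (𝔇 p) (+ A ∷ + (p ℕ.^ s) ∷ + B ∷ []) MulPowD →
                    B ≡ A ℕ.* p ℕ.^ s
    mulPowD-sound {A} {s} {B} 1≤B (A∣ₚB , A∣B , A+1∣ₚ , _ , A+2∣ₚ , _) = mulPow-sound
      ( (s , inj₁ (sym (ℕP.*-identityˡ _)))
      , ℕP.m≤n⇒∃[o]m+o≡n (ℕD.∣⇒≤ {{ℕ.>-nonZero 1≤B}} A∣B)
      , divₚ-ℤ⇒ℕ _ _ A∣ₚB , divₚ-ℤ⇒ℕ _ _ A+1∣ₚ , divₚ-ℤ⇒ℕ _ _ A+2∣ₚ)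

    mulPowD-complete : ∀ A s {B} → B ≡ A ℕ.* p ℕ.^ s → Sat (𝔇 p) (+ A ∷ + (p ℕ.^ s) ∷ + B ∷ []) MulPowD
    mulPowD-complete A s refl with mulPow-complete A s refl
    ... | _ , _ , A∣ₚ , A+1∣ₚ , A+2∣ₚ =
        divₚ-ℕ⇒ℤ _ _ A∣ₚ , ℕD.m∣m*n (p ℕ.^ s)
      , divₚ-ℕ⇒ℤ _ _ A+1∣ₚ , ℕD.divides (p ℕ.^ s) (distrib₁ A (p ℕ.^ s))
      , divₚ-ℕ⇒ℤ _ _ A+2∣ₚ , ℕD.divides (p ℕ.^ s) (distrib₂ A (p ℕ.^ s))
      where
        distrib₁ : ∀ A x → A ℕ.* x ℕ.+ x ≡ x ℕ.* (A ℕ.+ 1)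
        distrib₁ = ℕ-Solver.solve-∀
        distrib₂ : ∀ A x → A ℕ.* x ℕ.+ x ℕ.+ x ≡ x ℕ.* (A ℕ.+ 1 ℕ.+ 1)
        distrib₂ = ℕ-Solver.solve-∀

    -- Small(x, z) implies |x| < z: x divides E = W - P > 0 with W ∣ z.
    small-sound : ∀ {x z} → 1 ≤ z → Sat (𝔇 p) (x ∷ + z ∷ []) Small → ∣ x ∣ < z
    small-sound 1≤z (inj₁ refl) = 1≤z
    small-sound {x} {z} 1≤z (inj₂ (W , P , E , hW , hP , E+P≡W , E∉ , x∣E , W∣z , P∣W))
      with posPow-sound (subF⇒ (E ∷ P ∷ W ∷ x ∷ + z ∷ []) (v 2 ∷ []) PosPow hW)
         | posPow-sound (subF⇒ (E ∷ P ∷ W ∷ x ∷ + z ∷ []) (v 1 ∷ []) PosPow hP)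
    ... | a , refl | b , refl = begin-strict
      ∣ x ∣                       ≤⟨ ℕD.∣⇒≤ {{ℕ.≢-nonZero E≢0}} (subst (λ w → ∣ x ∣ ℕD.∣ ∣ w ∣) E≡ x∣E) ⟩
      p ℕ.^ a ℕ.∸ p ℕ.^ b         <⟨ ℕP.∸-monoʳ-< {p ℕ.^ a} {p ℕ.^ b} {0} (ℕP.m^n>0 p b) pᵇ≤pᵃ ⟩
      p ℕ.^ a                     ≤⟨ ℕD.∣⇒≤ {{ℕ.>-nonZero 1≤z}} W∣z ⟩
      z                           ∎
      where
        open ℕP.≤-Reasoning
        pᵇ≤pᵃ : p ℕ.^ b ≤ p ℕ.^ a
        pᵇ≤pᵃ = ℕD.∣⇒≤ {{ℕP.m^n≢0 p a}} P∣W
        E≡ : E ≡ + (p ℕ.^ a ℕ.∸ p ℕ.^ b)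
        E≡ = difference-of-naturals E+P≡W pᵇ≤pᵃ
        E≢0 : p ℕ.^ a ℕ.∸ p ℕ.^ b ≢ 0
        E≢0 e = proj₁ (proj₂ E∉) (trans E≡ (cong (+_) e))

    -- Certificates of smallness: x = 0, or |x| divides Bʲ - Bⁱ for some i < j;
    -- the size of the certificate is j.  Every integer has one (pigeonhole),
    -- and multiplying x by Bᵏ adds at most k to the size.
    Cert : ℤ → Set
    Cert x = (x ≡ 0ℤ) ⊎ Σ ℕ λ i → Σ ℕ λ j → (i < j) × (∣ x ∣ ℕD.∣ B ℕ.^ j ℕ.∸ B ℕ.^ i)

    size : ∀ {x} → Cert x → ℕ
    size (inj₁ _)             = 0
    size (inj₂ (_ , j , _)) = j

    certify : ∀ x → Cert x
    certify (+ zero)  = inj₁ refl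
    certify (+ suc n) = inj₂ (powers-collide B (suc n))
    certify -[1+ n ]  = inj₂ (powers-collide B (suc n))

    certify-mul : ∀ x k → (c : Cert x) → Σ (Cert (x * + (B ℕ.^ k))) λ c′ → size c′ ≤ size c ℕ.+ k
    certify-mul x k (inj₁ refl) = inj₁ refl , z≤n
    certify-mul x k (inj₂ (i , j , i<j , |x|∣)) =
      inj₂ (k ℕ.+ i , k ℕ.+ j , ℕP.+-monoʳ-< k i<j , |xBᵏ|∣) , ℕP.≤-reflexive (ℕP.+-comm k j)
      where
        open ≡-Reasoning
        |xBᵏ|∣ : ∣ x * + (B ℕ.^ k) ∣ ℕD.∣ B ℕ.^ (k ℕ.+ j) ℕ.∸ B ℕ.^ (k ℕ.+ i)
        |xBᵏ|∣ = subst₂ ℕD._∣_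
          (trans (ℕP.*-comm (B ℕ.^ k) ∣ x ∣) (sym (ℤP.abs-* x (+ (B ℕ.^ k)))))
          (begin
            B ℕ.^ k ℕ.* (B ℕ.^ j ℕ.∸ B ℕ.^ i)                 ≡⟨ ℕP.*-distribˡ-∸ (B ℕ.^ k) (B ℕ.^ j) (B ℕ.^ i) ⟩
            B ℕ.^ k ℕ.* B ℕ.^ j ℕ.∸ B ℕ.^ k ℕ.* B ℕ.^ i       ≡⟨ cong₂ ℕ._∸_ (ℕP.^-distribˡ-+-* B k j) (ℕP.^-distribˡ-+-* B k i) ⟨
            B ℕ.^ (k ℕ.+ j) ℕ.∸ B ℕ.^ (k ℕ.+ i)               ∎)
          (ℕD.*-monoʳ-∣ (B ℕ.^ k) |x|∣)

    pow-∣ : ∀ {m k} → m ≤ k → B ℕ.^ m ℕD.∣ B ℕ.^ k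
    pow-∣ {m} m≤k with ℕP.m≤n⇒∃[o]m+o≡n m≤k
    ... | o , refl = ℕD.divides (B ℕ.^ o) (trans (ℕP.^-distribˡ-+-* B m o) (ℕP.*-comm (B ℕ.^ m) (B ℕ.^ o)))

    2≤Bʲ-Bⁱ : ∀ {i j} → i < j → 2 ≤ B ℕ.^ j ℕ.∸ B ℕ.^ i
    2≤Bʲ-Bⁱ {i} {j} i<j = begin
      2                                     ≤⟨ ℕP.∸-monoˡ-≤ 1 3≤B ⟩
      B ℕ.∸ 1                               ≤⟨ ℕP.m≤m*n (B ℕ.∸ 1) (B ℕ.^ i) {{ℕP.m^n≢0 B i}} ⟩
      (B ℕ.∸ 1) ℕ.* B ℕ.^ i                 ≡⟨ ℕP.*-distribʳ-∸ (B ℕ.^ i) B 1 ⟩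
      B ℕ.* B ℕ.^ i ℕ.∸ 1 ℕ.* B ℕ.^ i       ≡⟨ cong (B ℕ.* B ℕ.^ i ℕ.∸_) (ℕP.*-identityˡ (B ℕ.^ i)) ⟩
      B ℕ.^ suc i ℕ.∸ B ℕ.^ i               ≤⟨ ℕP.∸-monoˡ-≤ (B ℕ.^ i) (ℕP.^-monoʳ-≤ B i<j) ⟩
      B ℕ.^ j ℕ.∸ B ℕ.^ i                   ∎
      where open ℕP.≤-Reasoning

    small-complete : ∀ {x} k → (c : Cert x) → size c ≤ k → Sat (𝔇 p) (x ∷ + (B ℕ.^ k) ∷ []) Small
    small-complete k (inj₁ x≡0) _ = inj₁ x≡0
    small-complete {x} k (inj₂ (i , j , i<j , |x|∣)) j≤k = inj₂
      ( + B ℕ.^ j , + B ℕ.^ i , + E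
      , subF⇐ ρ (v 2 ∷ []) PosPow (posPow-complete j)
      , subF⇐ ρ (v 1 ∷ []) PosPow (posPow-complete i)
      , cong (+_) (ℕP.m∸n+n≡m (ℕP.^-monoʳ-≤ B (ℕP.<⇒≤ i<j)))
      , nonunit-≥2 (2≤Bʲ-Bⁱ i<j)
      , |x|∣
      , pow-∣ j≤k
      , pow-∣ (ℕP.<⇒≤ i<j))
      where
        E = B ℕ.^ j ℕ.∸ B ℕ.^ i
        ρ = + E ∷ + B ℕ.^ i ∷ + B ℕ.^ j ∷ x ∷ + B ℕ.^ k ∷ []

    repD-sound : ∀ {k e} Z s → ∣ k ∣ < Z → (p ℕ.^ s ℕ.∸ 1 ≡ 0 ⊎ Z ℕ.+ Z ≤ p ℕ.^ s ℕ.∸ 1) →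
                 Sat (𝔇 p) (k ∷ + Z ∷ + (p ℕ.^ s) ∷ e ∷ []) RepD → RepWitness k (+ (p ℕ.^ s ℕ.∸ 1)) e
    repD-sound {k} {e} Z s |k|<Z bound
      (zu , U₂ , Sq , U , Y , D , E , hzu , zu≡ , hU₂ , U₂≡ , U+1≡u , Sq+2u≡ , hY , D+k≡Y , u∣Y , U∣D , U∣e , E+D≡e , Sq∣E)
      with posPow-sound (subF⇒ (E ∷ D ∷ Y ∷ U ∷ Sq ∷ U₂ ∷ zu ∷ k ∷ + Z ∷ + (p ℕ.^ s) ∷ e ∷ []) (v 6 ∷ []) PosPow hzu)
         | posPow-sound (subF⇒ (E ∷ D ∷ Y ∷ U ∷ Sq ∷ U₂ ∷ zu ∷ k ∷ + Z ∷ + (p ℕ.^ s) ∷ e ∷ []) (v 5 ∷ []) PosPow hU₂)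
    ... | a , refl | b , refl =
      repD-arith {k} {e} {Sq} {U} {Y} {D} {E} {Z} {p ℕ.^ s} (ℕP.m^n>0 p s) |k|<Z bound U+1≡u
        (trans Sq+2u≡ (cong (λ x → + x + 1ℤ) pᵇ≡)) |Y|<zu D+k≡Y
        (∣ᵤ⇒∣ u∣Y) (∣ᵤ⇒∣ U∣D) (∣ᵤ⇒∣ U∣e) E+D≡e (∣ᵤ⇒∣ Sq∣E)
      where
        ρ = E ∷ D ∷ Y ∷ U ∷ Sq ∷ + p ℕ.^ b ∷ + p ℕ.^ a ∷ k ∷ + Z ∷ + (p ℕ.^ s) ∷ e ∷ []
        pᵇ≡ : p ℕ.^ b ≡ p ℕ.^ s ℕ.* p ℕ.^ s
        pᵇ≡ = mulPowD-sound {p ℕ.^ s} {s} (ℕP.m^n>0 p b) (subF⇒ ρ (v 9 ∷ v 9 ∷ v 5 ∷ []) MulPowD U₂≡)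
        |Y|<zu : ∣ Y ∣ < Z ℕ.* p ℕ.^ s
        |Y|<zu = subst (∣ Y ∣ <_) (mulPowD-sound {Z} {s} (ℕP.m^n>0 p a) (subF⇒ ρ (v 8 ∷ v 9 ∷ v 6 ∷ []) MulPowD zu≡))
                       (small-sound (ℕP.m^n>0 p a) (subF⇒ ρ (v 2 ∷ v 6 ∷ []) Small hY))

    mulPowD-complete-B : ∀ A k {y} → y ≡ A ℕ.* B ℕ.^ k → Sat (𝔇 p) (+ A ∷ + B ℕ.^ k ∷ + y ∷ []) MulPowD
    mulPowD-complete-B A k {y} y≡ = subst (λ x → Sat (𝔇 p) (+ A ∷ + x ∷ + y ∷ []) MulPowD) (sym (Bⁿ≡ k))
      (mulPowD-complete A (6 ℕ.* k) (trans y≡ (cong (A ℕ.*_) (Bⁿ≡ k))))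

    repD-complete : ∀ {k e} kz ku (c : Cert k) → size c ≤ kz → RepWitness k (+ (B ℕ.^ ku ℕ.∸ 1)) e →
                    Sat (𝔇 p) (k ∷ + B ℕ.^ kz ∷ + B ℕ.^ ku ∷ e ∷ []) RepD
    repD-complete {k} {e} kz ku c size≤kz w@(witness r e≡rU _) =
        + B ℕ.^ (kz ℕ.+ ku) , + B ℕ.^ (ku ℕ.+ ku) , Sq , U , Y , D , e - D
      , subF⇐ ρ (v 6 ∷ []) PosPow (posPow-complete (kz ℕ.+ ku))
      , subF⇐ ρ (v 8 ∷ v 9 ∷ v 6 ∷ []) MulPowD (mulPowD-complete-B (B ℕ.^ kz) ku (ℕP.^-distribˡ-+-* B kz ku))
      , subF⇐ ρ (v 5 ∷ []) PosPow (posPow-complete (ku ℕ.+ ku))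
      , subF⇐ ρ (v 9 ∷ v 9 ∷ v 5 ∷ []) MulPowD (mulPowD-complete-B (B ℕ.^ ku) ku (ℕP.^-distribˡ-+-* B ku ku))
      , cong (+_) (ℕP.m∸n+n≡m (1≤Bⁿ ku))
      , trans (square-of-pred m (1≤Bⁿ ku)) (cong (λ x → + x + 1ℤ) (sym (ℕP.^-distribˡ-+-* B ku ku)))
      , subF⇐ ρ (v 2 ∷ v 6 ∷ []) Small (small-complete (kz ℕ.+ ku) c′ (ℕP.≤-trans size≤ (ℕP.+-monoˡ-≤ ku size≤kz)))
      , times-pred k m (1≤Bⁿ ku)
      , ∣⇒∣ᵤ (∣n⇒∣m*n k (∣-refl {+ m}))
      , ∣⇒∣ᵤ (∣n⇒∣m*n k (∣-refl {U}))
      , ∣⇒∣ᵤ (divides r e≡rU)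
      , sub-add e D
      , ∣⇒∣ᵤ (rep-witness-to w)
      where
        m = B ℕ.^ ku
        U = + (m ℕ.∸ 1)
        Sq = U * U
        Y = k * + m
        D = k * U
        c′ = proj₁ (certify-mul k ku c)
        size≤ = proj₂ (certify-mul k ku c)
        ρ = e - D ∷ D ∷ Y ∷ U ∷ Sq ∷ + B ℕ.^ (ku ℕ.+ ku) ∷ + B ℕ.^ (kz ℕ.+ ku) ∷ k ∷ + B ℕ.^ kz ∷ + m ∷ e ∷ []
        square-of-pred : ∀ m → 1 ≤ m → (+ (m ℕ.∸ 1) * + (m ℕ.∸ 1) + + m) + + m ≡ + (m ℕ.* m) + 1ℤ
        square-of-pred (suc M) _ = sym (square-of-successor M)
        times-pred : ∀ k m → 1 ≤ m → k * + (m ℕ.∸ 1) + k ≡ k * + m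
        times-pred k (suc M) _ = expand k (+ M)
          where
            expand : ∀ k M → k * M + k ≡ k * (1ℤ + M)
            expand = solve-∀
        sub-add : ∀ e D → e - D + D ≡ e
        sub-add = solve-∀

    μ₃-sound : ∀ a b c → Sat (𝔇 p) (a ∷ b ∷ c ∷ []) μ₃ → c ≡ a * b
    μ₃-sound a b c
      ( z , z₂ , g , g₂ , u , v′ , V , W , hz , hz₂ , z₂≡zz , hg , g₂+2≡g , g₂∉ , hu , u≡z₂g , hv
      , a-small , b-small , c-small , V+1≡v , rep-a , rep-b , rep-c)
      with posPow-sound (subF⇒ ρ (v 7 ∷ []) PosPow hz) | posPow-sound (subF⇒ ρ (v 6 ∷ []) PosPow hz₂)
         | posPow-sound (subF⇒ ρ (v 5 ∷ []) PosPow hg) | posPow-sound (subF⇒ ρ (v 3 ∷ []) PosPow hu)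
         | posPow-sound (subF⇒ ρ (v 2 ∷ []) PosPow hv)
      where ρ = W ∷ V ∷ v′ ∷ u ∷ g₂ ∷ g ∷ z₂ ∷ z ∷ a ∷ b ∷ c ∷ []
    ... | ez , refl | e₂ , refl | eg , refl | eu , refl | ev , refl =
      product-from-congruence {a} {b} {c} (repunit-product-ℤ rep-a′ rep-b′ rep-c′) |a|<Z |b|<Z |c|<Z² 2Z²≤U
      where
        Z = p ℕ.^ ez
        Z₂ = p ℕ.^ e₂
        U = p ℕ.^ eu ℕ.∸ 1
        ρ = W ∷ V ∷ + p ℕ.^ ev ∷ + p ℕ.^ eu ∷ g₂ ∷ + p ℕ.^ eg ∷ + Z₂ ∷ + Z ∷ a ∷ b ∷ c ∷ []
        Z₂≡ : Z₂ ≡ Z ℕ.* Z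
        Z₂≡ = mulPowD-sound {Z} {ez} (ℕP.m^n>0 p e₂) (subF⇒ ρ (v 7 ∷ v 7 ∷ v 6 ∷ []) MulPowD z₂≡zz)
        u≡ : p ℕ.^ eu ≡ Z ℕ.* Z ℕ.* p ℕ.^ eg
        u≡ = trans (mulPowD-sound {Z₂} {eg} (ℕP.m^n>0 p eu) (subF⇒ ρ (v 6 ∷ v 5 ∷ v 3 ∷ []) MulPowD u≡z₂g))
                   (cong (ℕ._* p ℕ.^ eg) Z₂≡)
        2Z²≤U : Z ℕ.* Z ℕ.+ Z ℕ.* Z ≤ U
        2Z²≤U = subst (λ x → Z ℕ.* Z ℕ.+ Z ℕ.* Z ≤ x ℕ.∸ 1) (sym u≡)
                  (room (ℕP.m^n>0 p ez) (at-least-4 (ℕP.m^n>0 p eg) g₂+2≡g g₂∉))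
        2Z≤U : Z ℕ.+ Z ≤ U
        2Z≤U = ℕP.≤-trans (ℕP.+-mono-≤ Z≤Z² Z≤Z²) 2Z²≤U
          where Z≤Z² = ℕP.m≤m*n Z Z {{ℕP.m^n≢0 p ez}}
        instance
          U≢0 : ℤ.NonZero (+ U)
          U≢0 = ℕ.>-nonZero (ℕP.≤-trans (ℕP.≤-trans (ℕP.m^n>0 p ez) (ℕP.m≤m+n Z Z)) 2Z≤U)
        |a|<Z : ∣ a ∣ < Z
        |a|<Z = small-sound (ℕP.m^n>0 p ez) (subF⇒ ρ (v 8 ∷ v 7 ∷ []) Small a-small)
        |b|<Z : ∣ b ∣ < Z
        |b|<Z = small-sound (ℕP.m^n>0 p ez) (subF⇒ ρ (v 9 ∷ v 7 ∷ []) Small b-small)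
        |c|<Z₂ : ∣ c ∣ < Z₂
        |c|<Z₂ = small-sound (ℕP.m^n>0 p e₂) (subF⇒ ρ (v 10 ∷ v 6 ∷ []) Small c-small)
        |c|<Z² : ∣ c ∣ < Z ℕ.* Z
        |c|<Z² = subst (∣ c ∣ <_) Z₂≡ |c|<Z₂
        V≡ : V ≡ + (p ℕ.^ ev ℕ.∸ 1)
        V≡ = difference-of-naturals V+1≡v (ℕP.m^n>0 p ev)
        rep-a′ : RepWitness a (+ U) V
        rep-a′ = repD-sound Z eu |a|<Z (inj₂ 2Z≤U) (subF⇒ ρ (v 8 ∷ v 7 ∷ v 3 ∷ v 1 ∷ []) RepD rep-a)
        -- v - 1 is 0 or a multiple of U, hence at least 2Z.
        room-v : p ℕ.^ ev ℕ.∸ 1 ≡ 0 ⊎ Z ℕ.+ Z ≤ p ℕ.^ ev ℕ.∸ 1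
        room-v with p ℕ.^ ev ℕ.∸ 1 ℕ.≟ 0
        ... | yes V≡0 = inj₁ V≡0
        ... | no V≢0 = inj₂ (ℕP.≤-trans 2Z≤U (ℕD.∣⇒≤ {{ℕ.≢-nonZero V≢0}} U∣V))
          where
            U∣V : U ℕD.∣ p ℕ.^ ev ℕ.∸ 1
            U∣V = subst (λ x → U ℕD.∣ ∣ x ∣) V≡ (∣⇒∣ᵤ (divides (RepWitness.r rep-a′) (RepWitness.e≡r·U rep-a′)))
        rep-b′ : RepWitness b V W
        rep-b′ = subst (λ x → RepWitness b x W) (sym V≡)
                   (repD-sound Z ev |b|<Z room-v (subF⇒ ρ (v 9 ∷ v 7 ∷ v 2 ∷ v 0 ∷ []) RepD rep-b))
        rep-c′ : RepWitness c (+ U) W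
        rep-c′ = repD-sound Z₂ eu |c|<Z₂ (inj₂ (subst (λ x → x ℕ.+ x ≤ U) (sym Z₂≡) 2Z²≤U))
                   (subF⇒ ρ (v 10 ∷ v 6 ∷ v 3 ∷ v 0 ∷ []) RepD rep-c)

    -- Completeness: z = B^kz with kz bounding the certificates of a, b, ab,
    -- u = B^(2kz+1), v = u^L₁ and w = v^L₂ with L₁ ≡ a, L₂ ≡ b.
    μ₃-complete : ∀ a b → Sat (𝔇 p) (a ∷ b ∷ a * b ∷ []) μ₃
    μ₃-complete a b =
        + B ℕ.^ kz , + B ℕ.^ k₂ , + B ℕ.^ 1 , + (B ℕ.∸ 2) , + u , + v′ , + V , + (w ℕ.∸ 1)
      , subF⇐ ρ (v 7 ∷ []) PosPow (posPow-complete kz)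
      , subF⇐ ρ (v 6 ∷ []) PosPow (posPow-complete k₂)
      , subF⇐ ρ (v 7 ∷ v 7 ∷ v 6 ∷ []) MulPowD (mulPowD-complete-B (B ℕ.^ kz) kz (ℕP.^-distribˡ-+-* B kz kz))
      , subF⇐ ρ (v 5 ∷ []) PosPow (posPow-complete 1)
      , cong (+_) (trans (ℕP.+-assoc (B ℕ.∸ 2) 1 1) (trans (ℕP.m∸n+n≡m (ℕP.≤-trans (s≤s (s≤s z≤n)) 3≤B)) (sym (ℕP.*-identityʳ B))))
      , nonunit-≥2 2≤B∸2
      , subF⇐ ρ (v 3 ∷ []) PosPow (posPow-complete ku)
      , subF⇐ ρ (v 6 ∷ v 5 ∷ v 3 ∷ []) MulPowD (mulPowD-complete-B (B ℕ.^ k₂) 1 (ℕP.^-distribˡ-+-* B k₂ 1))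
      , subF⇐ ρ (v 2 ∷ []) PosPow (posPow-complete kv)
      , subF⇐ ρ (v 8 ∷ v 7 ∷ []) Small (small-complete kz ca size-a≤)
      , subF⇐ ρ (v 9 ∷ v 7 ∷ []) Small (small-complete kz cb size-b≤)
      , subF⇐ ρ (v 10 ∷ v 6 ∷ []) Small (small-complete k₂ cc size-c≤)
      , cong (+_) (ℕP.m∸n+n≡m (1≤Bⁿ kv))
      , subF⇐ ρ (v 8 ∷ v 7 ∷ v 3 ∷ v 1 ∷ []) RepD (repD-complete kz ku ca size-a≤ rep-a)
      , subF⇐ ρ (v 9 ∷ v 7 ∷ v 2 ∷ v 0 ∷ []) RepD (repD-complete kz kv cb size-b≤ rep-b)
      , subF⇐ ρ (v 10 ∷ v 6 ∷ v 3 ∷ v 0 ∷ []) RepD (repD-complete k₂ ku cc size-c≤ rep-c)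
      where
        c = a * b
        ca = certify a
        cb = certify b
        cc = certify c
        kz = size ca ℕ.+ size cb ℕ.+ size cc
        k₂ = kz ℕ.+ kz
        ku = k₂ ℕ.+ 1
        u = B ℕ.^ ku
        U = u ℕ.∸ 1
        instance
          U≢0 : NonZero U
          U≢0 = ℕ.>-nonZero (ℕP.≤-trans (s≤s z≤n) (2≤Bᵏ∸1 (ℕP.m≤n+m 1 k₂)))
        -- v = u^L₁ with L₁ ≡ a (mod U), L₁ ≥ 1; w = v^L₂ with L₂ ≡ b (mod v - 1).
        L₁ = a %ℕ U ℕ.+ U
        kv = ku ℕ.* L₁
        v′ = B ℕ.^ kv
        V = v′ ℕ.∸ 1
        instance
          V≢0 : NonZero V
          V≢0 = ℕ.>-nonZero (ℕP.≤-trans (s≤s z≤n) (2≤Bᵏ∸1 (ℕP.*-mono-≤ (ℕP.m≤n+m 1 k₂) (ℕP.≤-trans (ℕ.>-nonZero⁻¹ U) (ℕP.m≤n+m U _)))))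
        L₂ = b %ℕ V
        kw = kv ℕ.* L₂
        w = B ℕ.^ kw
        ρ = + (w ℕ.∸ 1) ∷ + V ∷ + v′ ∷ + u ∷ + (B ℕ.∸ 2) ∷ + B ℕ.^ 1 ∷ + B ℕ.^ k₂ ∷ + B ℕ.^ kz ∷ a ∷ b ∷ c ∷ []
        size-a≤ : size ca ≤ kz
        size-a≤ = ℕP.≤-trans (ℕP.m≤m+n (size ca) (size cb)) (ℕP.m≤m+n _ (size cc))
        size-b≤ : size cb ≤ kz
        size-b≤ = ℕP.≤-trans (ℕP.m≤n+m (size cb) (size ca)) (ℕP.m≤m+n _ (size cc))
        size-c≤ : size cc ≤ k₂
        size-c≤ = ℕP.≤-trans (ℕP.m≤n+m (size cc) _) (ℕP.m≤m+n kz kz)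
        U∣a-L₁ : + U ∣ a - + L₁
        U∣a-L₁ = subst (+ U ∣_) (shift a (+ (a %ℕ U)) (+ U))
                   (∣m∣n⇒∣m+n (mod-representative a U) (∣m⇒∣-m (∣-refl {+ U})))
          where
            shift : ∀ a r U → a - r + - U ≡ a - (r + U)
            shift = solve-∀
        rep-a : RepWitness a (+ U) (+ V)
        rep-a = subst (λ x → RepWitness a (+ U) (+ (x ℕ.∸ 1))) (ℕP.^-*-assoc B ku L₁)
                  (power-RepWitness u L₁ (1≤Bⁿ ku) U∣a-L₁)
        U∣V : + U ∣ + V
        U∣V = divides (RepWitness.r rep-a) (RepWitness.e≡r·U rep-a)
        rep-b : RepWitness b (+ V) (+ (w ℕ.∸ 1))
        rep-b = subst (λ x → RepWitness b (+ V) (+ (x ℕ.∸ 1))) (ℕP.^-*-assoc B kv L₂)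
                  (power-RepWitness v′ L₂ (1≤Bⁿ kv) (mod-representative b V))
        rep-c : RepWitness c (+ U) (+ (w ℕ.∸ 1))
        rep-c = subst (λ x → RepWitness c (+ U) (+ (x ℕ.∸ 1))) u^L₁L₂≡w
                  (power-RepWitness u (L₁ ℕ.* L₂) (1≤Bⁿ ku) U∣c-L₁L₂)
          where
            u^L₁L₂≡w : u ℕ.^ (L₁ ℕ.* L₂) ≡ w
            u^L₁L₂≡w = trans (ℕP.^-*-assoc B ku (L₁ ℕ.* L₂)) (cong (B ℕ.^_) (sym (ℕP.*-assoc ku L₁ L₂)))
            U∣c-L₁L₂ : + U ∣ c - + (L₁ ℕ.* L₂)
            U∣c-L₁L₂ = subst (+ U ∣_) (trans (expand a b (+ L₁) (+ L₂)) (cong (λ x → a * b - x) (sym (ℤP.pos-* L₁ L₂))))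
              (∣m∣n⇒∣m+n (∣m⇒∣m*n b U∣a-L₁) (∣n⇒∣m*n (+ L₁) (∣-trans U∣V (mod-representative b V))))
              where
                expand : ∀ a b L₁ L₂ → (a - L₁) * b + L₁ * (b - L₂) ≡ a * b - L₁ * L₂
                expand = solve-∀

open import Defs
open Naturals using (μ₁; module Semantics𝔑)
open Integers using (μ₂; module Semanticsℨ)
open IntegersWithDivisibility using (μ₃; module Semantics𝔇)
open import Data.Nat using (ℕ; suc)
open import Data.Nat.Primality using (Prime)
open import Data.Integer using (ℤ)
open import Data.Nat as ℕ using ()
open import Data.Integer as ℤ using ()
open import Data.Vec using ([]; _∷_)
open import Data.Product using (Σ; _×_; _,_)
open import Function.Bundles using (_⇔_; mk⇔)
open import Relation.Binary.PropositionalEquality using (_≡_; refl)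

defines-product : ∀ {Rel} (M : Structure Rel) (let open Structure M) (_·_ : Carrier → Carrier → Carrier)
  (φ : PEFormula Rel 3) → (∀ a b c → Sat M (a ∷ b ∷ c ∷ []) φ → c ≡ a · b) →
  (∀ a b → Sat M (a ∷ b ∷ a · b ∷ []) φ) → ∀ a b c → Sat M (a ∷ b ∷ c ∷ []) φ ⇔ (c ≡ a · b)
defines-product M _·_ φ sound complete a b c = mk⇔ (sound a b c) λ { refl → complete a b }

multiplication-definable : ∀ q →
    ((a b c : ℕ) → Sat (𝔑 (2 ℕ.+ q)) (a ∷ b ∷ c ∷ []) μ₁ ⇔ (c ≡ a ℕ.* b))
  × ((a b c : ℤ) → Sat (ℨ (2 ℕ.+ q)) (a ∷ b ∷ c ∷ []) μ₂ ⇔ (c ≡ a ℤ.* b))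
  × ((a b c : ℤ) → Sat (𝔇 (2 ℕ.+ q)) (a ∷ b ∷ c ∷ []) μ₃ ⇔ (c ≡ a ℤ.* b))
multiplication-definable q =
    defines-product (𝔑 (2 ℕ.+ q)) ℕ._*_ μ₁ μ₁-sound μ₁-complete
  , defines-product (ℨ (2 ℕ.+ q)) ℤ._*_ μ₂ μ₂-sound μ₂-complete
  , defines-product (𝔇 (2 ℕ.+ q)) ℤ._*_ μ₃ μ₃-sound μ₃-complete
  where
    open Semantics𝔑 q
    open Semanticsℨ q
    open Semantics𝔇 q

-- Every prime is at least 2, so the theorem is an instance of the above.
theorem1p13 : Σ (PEFormula LangN 3) λ μ₁ → Σ (PEFormula LangZ 3) λ μ₂ → Σ (PEFormula LangD 3) λ μ₃ →
    ∀ (p : ℕ) → Prime p →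
    ((a b c : ℕ) → Sat (𝔑 p) (a ∷ b ∷ c ∷ []) μ₁ ⇔ (c ≡ a ℕ.* b))
    × ((a b c : ℤ) → Sat (ℨ p) (a ∷ b ∷ c ∷ []) μ₂ ⇔ (c ≡ a ℤ.* b))
    × ((a b c : ℤ) → Sat (𝔇 p) (a ∷ b ∷ c ∷ []) μ₃ ⇔ (c ≡ a ℤ.* b))
theorem1p13 = μ₁ , μ₂ , μ₃ , λ
  { (suc (suc q)) _ → multiplication-definable q
  ; 0 ()
  ; 1 () }
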